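{- Let $\alpha_k=0$ if $k=3r-1$, $\alpha_k=\frac{1-q^{6r+2}}{1-q^2}q^{6r^2+r}$ if $k=3r$, $\alpha_k=-\frac{1-q^{6r+4}}{1-q^2}q^{6r^2+5r+1}$ if $k=3r+1$. Then for every integer $p\ge1$, every positive integer $N$ and every primitive $N$th root of unity $q$, $$H_p^{(9)}(q)=q^{p}\sum_{k=0}^{N-1}(-1)^kq^{ -\binom{k+1}{2}}\bigl(q^{p(k^2+2k)}\alpha_k\bigr)^*.$$
   Context: $(a)_n=\prod_{k=1}^n(1-aq^{k-1})$, $\begin{bmatrix} n\\ k\end{bmatrix}=\frac{(q)_n}{(q)_{n-k}(q)_k}$. $H_p^{(9)}(q)=\sum_{n_p\ge\cdots\ge n_1\ge0}q^{ -n_p^2-n_p}(q^{n_p+1})_{n_p}\prod_{i=1}^{p-1}q^{n_i^2}\begin{bmatrix} n_{i+1}\\ n_i\end{bmatrix}$; at a root of unity only finitely many terms are nonzero. For $a_k=q^{p(k^2+2k)}\alpha_k$, $a_k^*:=(1-q^2)\left(\frac{a_k}{1-q^{2k+2}}-\frac{q^{2k}a_{k-1}}{1-q^{2k}}\right)$ with $a_{ -1}=0$; the quotients are simplified as rational functions in $q$ before evaluating, so that $(1-q^2)\alpha_k/(1-q^{2k+2})$ equals $q^{6r^2+r}$ for $k=3r$, $-q^{6r^2+5r+1}$ for $k=3r+1$, and $0$ for $k=3r-1$. -}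

module Defs where

open import Level using (Level)
open import Data.Nat as ℕ using (ℕ; zero; suc; _∸_; _<_)
open import Data.Product using (Σ; ∃; _×_)
open import Relation.Nullary using (¬_)
open import Algebra.Bundles using (CommutativeRing; Semiring)

module _ {c ℓ : Level} (R : CommutativeRing c ℓ) where
  open CommutativeRing R using (_≈_; _+_; _*_; -_; _-_; 0#; 1#; +-rawMonoid; semiring) renaming (Carrier to A)
  open import Algebra.Definitions.RawSemiring (Semiring.rawSemiring semiring) using (_^_)
  import Algebra.Definitions.RawMonoid +-rawMonoid as AddM

  IsFieldCR : Set (c Level.⊔ ℓ)
  IsFieldCR = ∀ x → ¬ (x ≈ 0#) → ∃ λ y → (x * y) ≈ 1#

  CharZero : Set ℓ
  CharZero = ∀ (n : ℕ) → ¬ ((suc n AddM.× 1#) ≈ 0#)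

  PrimitiveRoot : ℕ → A → Set ℓ
  PrimitiveRoot N q = ((q ^ N) ≈ 1#) × (∀ k → 0 < k → k < N → ¬ ((q ^ k) ≈ 1#))

  sumTo : ℕ → (ℕ → A) → A
  sumTo zero    f = 0#
  sumTo (suc n) f = sumTo n f + f n

  prodTo : ℕ → (ℕ → A) → A
  prodTo zero    f = 1#
  prodTo (suc n) f = prodTo n f * f n

  sgn : ℕ → A
  sgn zero    = 1#
  sgn (suc k) = - sgn k

  -- binomial (k+1 choose 2) = k(k+1)/2
  tri : ℕ → ℕ
  tri zero    = 0
  tri (suc k) = suc k ℕ.+ tri k

  module _ (q : A) where
    gauss : ℕ → ℕ → A
    gauss n       zero    = 1#
    gauss zero    (suc k) = 0#
    gauss (suc n) (suc k) = gauss n k + (q ^ suc k) * gauss n (suc k)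

    shiftedPoch : ℕ → A
    shiftedPoch n = prodTo n (λ j → 1# - q ^ (suc n ℕ.+ j))

    -- inner j m = Σ_{m ≥ n_j ≥ ... ≥ n_1 ≥ 0} Π_{i=1}^{j} q^{n_i^2} [n_{i+1} n_i]  with n_{j+1} = m
    inner : ℕ → ℕ → A
    inner zero    m = 1#
    inner (suc j) m = sumTo (suc m) (λ n → (q ^ (n ℕ.* n)) * gauss m n * inner j n)

  module _ (N : ℕ) (q : A) where
    -- q^{-1}; for a primitive N-th root of unity q^{-1} = q^{N-1}
    qinv : A
    qinv = q ^ (N ∸ 1)

    -- H_p^{(9)}(q), summing over n_p ≤ N-1 (all terms with n_p ≥ N vanish at q)
    H9 : ℕ → A
    H9 p = sumTo N (λ m → (qinv ^ (m ℕ.* m ℕ.+ m)) * shiftedPoch q m * inner q (p ∸ 1) m)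

    -- b_k = (1-q^2) a_k / (1-q^{2k+2}) simplified, where a_k = q^{p(k^2+2k)} α_k:
    --   k = 3r   : q^{p(k^2+2k)} q^{6r^2+r}
    --   k = 3r+1 : - q^{p(k^2+2k)} q^{6r^2+5r+1}
    --   k = 3r+2 : 0
    βq : ℕ → ℕ → A
    βq r 0 = q ^ (6 ℕ.* r ℕ.* r ℕ.+ r)
    βq r 1 = - (q ^ (6 ℕ.* r ℕ.* r ℕ.+ 5 ℕ.* r ℕ.+ 1))
    βq r _ = 0#

    b : ℕ → ℕ → A
    b p k = (q ^ (p ℕ.* (k ℕ.* k ℕ.+ 2 ℕ.* k))) * βq (k ℕ./ 3) (k ℕ.% 3)

    -- a_k^* = (1-q^2) (a_k/(1-q^{2k+2}) - q^{2k} a_{k-1}/(1-q^{2k})),  a_{-1} = 0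
    astar : ℕ → ℕ → A
    astar p zero    = b p zero
    astar p (suc k) = b p (suc k) - (q ^ (2 ℕ.* suc k)) * b p k

    RHS9 : ℕ → A
    RHS9 p = (q ^ p) * sumTo N (λ k → sgn k * (qinv ^ tri k) * astar p k)

-- The inner sums of H_p^{(9)} arise by applying the Bailey lemma p times to the unit Bailey pair, whose
-- α_r is 1 for r = 0 and (−1)^r q^{r(r−1)/2} (1 + q^r) otherwise; for w_m = (q)_m β_m the lemma reads
-- w_m ↦ Σ_n q^{n²} [m, n] w_n, α_r ↦ q^{r²} α_r. Hence (q^{m+1})_m times the inner sum is
-- Σ_r [2m, m+r] q^{p r²} α_r. At a primitive N-th root of unity the lemma survives for m < N, where (q)_m
-- is invertible. Exchanging the sums over m and r and putting r = N − 1 − k, the sum over m collapses,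
-- by q^N = 1, to q^{−k(k+1)} D(2k+1), where D(n) = Σ_i (−1)^i q^{i(i−1)/2} [n−i, i] satisfies
-- D(n+3) = −q^{n+1} D(n); this recursion produces the period-3 pattern of α_k in the statement. What
-- remains is the telescoped form of Σ_k (−1)^k q^{−k(k+1)/2} a_k^*.

module Submission where

open import Defs
open import Level using (Level)
open import Data.Nat using (ℕ; _≤_)
open import Algebra.Bundles using (CommutativeRing)

open import Algebra.Bundles using (RawRing; Semiring)
open import Algebra.Solver.Ring.AlmostCommutativeRing using (fromCommutativeRing; _-Raw-AlmostCommutative⟶_)
open import Data.Maybe using (Maybe; just; nothing)
open import Data.Nat as ℕ using (zero; suc; _∸_; _<_; z≤n; s≤s)
import Data.Nat.Properties as ℕ
open import Data.Nat.DivMod using (m≡m%n+[m/n]*n; m%n<n)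
open import Data.Nat.Tactic.RingSolver using (solve-∀)
open import Data.Product using (_×_; _,_; ∃; proj₁; proj₂)
open import Relation.Nullary using (yes; no; ¬_)
open import Relation.Binary.PropositionalEquality as ≡ using (_≡_)

-- The standard library's ring solver needs a coefficient ring mapping into R. We take pairs of
-- naturals, (a , b) standing for a − b, so that integer constants and cancellation are available
-- in an arbitrary commutative ring.
module IntegerCoefficientSolver {ℓ₁ ℓ₂} (R : CommutativeRing ℓ₁ ℓ₂) where
  open CommutativeRing R hiding (zero)
  open import Algebra.Properties.Semiring.Mult semiring using (×-homo-+; ×1-homo-*; ×-congˡ) renaming (_×_ to _·_)
  open import Algebra.Properties.Ring ring using (-‿distribˡ-*; -‿distribʳ-*; -‿involutive; -0#≈0#)
  open import Algebra.Properties.AbelianGroup +-abelianGroup using (⁻¹-∙-comm)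
  open import Algebra.Properties.CommutativeSemigroup +-commutativeSemigroup using (interchange)
  open import Relation.Binary.Reasoning.Setoid setoid

  private
    ℕ²-rawRing : RawRing _ _
    ℕ²-rawRing = record
      { Carrier = ℕ × ℕ
      ; _≈_ = _≡_
      ; _+_ = λ { (a , b) (c , d) → a ℕ.+ c , b ℕ.+ d }
      ; _*_ = λ { (a , b) (c , d) → a ℕ.* c ℕ.+ b ℕ.* d , a ℕ.* d ℕ.+ b ℕ.* c }
      ; -_ = λ { (a , b) → b , a }
      ; 0# = 0 , 0
      ; 1# = 1 , 0
      }

    difference : ℕ × ℕ → Carrier
    difference (a , b) = a · 1# - b · 1#

    -+-distrib : ∀ x y → - (x + y) ≈ - x + - y
    -+-distrib x y = sym (⁻¹-∙-comm x y)

    difference-+ : ∀ a b c d → difference (a ℕ.+ c , b ℕ.+ d) ≈ difference (a , b) + difference (c , d)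
    difference-+ a b c d = begin
      (a ℕ.+ c) · 1# - (b ℕ.+ d) · 1#  ≈⟨ +-cong (×-homo-+ 1# a c) (-‿cong (×-homo-+ 1# b d)) ⟩
      (A + C) - (B + D)                ≈⟨ +-congˡ (-+-distrib B D) ⟩
      (A + C) + (- B + - D)            ≈⟨ interchange A C (- B) (- D) ⟩
      (A - B) + (C - D)                ∎
      where A = a · 1#; B = b · 1#; C = c · 1#; D = d · 1#

    difference-* : ∀ a b c d →
      difference (a ℕ.* c ℕ.+ b ℕ.* d , a ℕ.* d ℕ.+ b ℕ.* c) ≈ difference (a , b) * difference (c , d)
    difference-* a b c d = begin
      (a ℕ.* c ℕ.+ b ℕ.* d) · 1# - (a ℕ.* d ℕ.+ b ℕ.* c) · 1#
        ≈⟨ +-cong (×1-homo-+* a c b d) (-‿cong (×1-homo-+* a d b c)) ⟩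
      (A * C + B * D) - (A * D + B * C)          ≈⟨ +-congˡ (-+-distrib (A * D) (B * C)) ⟩
      (A * C + B * D) + (- (A * D) + - (B * C))  ≈⟨ interchange (A * C) (B * D) (- (A * D)) (- (B * C)) ⟩
      (A * C - A * D) + (B * D - B * C)          ≈⟨ +-cong (+-congˡ (-‿distribʳ-* A D)) (+-comm (B * D) (- (B * C))) ⟩
      (A * C + A * - D) + (- (B * C) + B * D)    ≈⟨ +-congˡ (+-cong (-‿distribˡ-* B C) (sym negated)) ⟩
      (A * C + A * - D) + (- B * C + - B * - D)  ≈⟨ sym (+-cong (distribˡ A C (- D)) (distribˡ (- B) C (- D))) ⟩
      A * (C - D) + - B * (C - D)                ≈⟨ sym (distribʳ (C - D) A (- B)) ⟩
      (A - B) * (C - D)                          ∎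
      where
      A = a · 1#; B = b · 1#; C = c · 1#; D = d · 1#
      ×1-homo-+* : ∀ m n o p → (m ℕ.* n ℕ.+ o ℕ.* p) · 1# ≈ m · 1# * n · 1# + o · 1# * p · 1#
      ×1-homo-+* m n o p = trans (×-homo-+ 1# (m ℕ.* n) (o ℕ.* p)) (+-cong (×1-homo-* m n) (×1-homo-* o p))
      negated : - B * - D ≈ B * D
      negated = trans (sym (-‿distribˡ-* B (- D))) (trans (-‿cong (sym (-‿distribʳ-* B D))) (-‿involutive (B * D)))

    -- ⟦ (a , b) ⟧ cancels common successors first, so that the constants (1 , 0), (0 , 0) and
    -- (0 , 1) denote 1#, 0# and - 1# definitionally and solved equations match the goals.
    fromℕ : ℕ → Carrier
    fromℕ zero          = 0#
    fromℕ (suc zero)    = 1#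
    fromℕ (suc (suc n)) = 1# + fromℕ (suc n)

    ⟦_⟧ : ℕ × ℕ → Carrier
    ⟦ a     , zero  ⟧ = fromℕ a
    ⟦ zero  , suc b ⟧ = - fromℕ (suc b)
    ⟦ suc a , suc b ⟧ = ⟦ a , b ⟧

    fromℕ≈×1 : ∀ n → fromℕ n ≈ n · 1#
    fromℕ≈×1 zero          = refl
    fromℕ≈×1 (suc zero)    = sym (+-identityʳ 1#)
    fromℕ≈×1 (suc (suc n)) = +-congˡ (fromℕ≈×1 (suc n))

    ⟦⟧≈difference : ∀ a b → ⟦ a , b ⟧ ≈ difference (a , b)
    ⟦⟧≈difference a zero = begin
      fromℕ a             ≈⟨ fromℕ≈×1 a ⟩
      a · 1#              ≈⟨ sym (+-identityʳ _) ⟩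
      a · 1# + 0#         ≈⟨ +-congˡ (sym -0#≈0#) ⟩
      a · 1# - 0#         ∎
    ⟦⟧≈difference zero (suc b) = trans (-‿cong (fromℕ≈×1 (suc b))) (sym (+-identityˡ _))
    ⟦⟧≈difference (suc a) (suc b) = begin
      ⟦ a , b ⟧                   ≈⟨ ⟦⟧≈difference a b ⟩
      A - B                       ≈⟨ sym (+-identityʳ _) ⟩
      (A - B) + 0#                ≈⟨ +-congˡ (sym (-‿inverseʳ 1#)) ⟩
      (A + - B) + (1# + - 1#)     ≈⟨ interchange A (- B) 1# (- 1#) ⟩
      (A + 1#) + (- B + - 1#)     ≈⟨ +-cong (+-comm A 1#) (sym (-+-distrib B 1#)) ⟩
      (1# + A) - (B + 1#)         ≈⟨ +-congˡ (-‿cong (+-comm B 1#)) ⟩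
      (1# + A) - (1# + B)         ∎
      where A = a · 1#; B = b · 1#

    ⟦⟧-homomorphism : ℕ²-rawRing -Raw-AlmostCommutative⟶ fromCommutativeRing R
    ⟦⟧-homomorphism = record
      { ⟦_⟧    = ⟦_⟧
      ; +-homo = λ { (a , b) (c , d) → trans (⟦⟧≈difference (a ℕ.+ c) (b ℕ.+ d)) (trans (difference-+ a b c d)
                                         (sym (+-cong (⟦⟧≈difference a b) (⟦⟧≈difference c d)))) }
      ; *-homo = λ { (a , b) (c , d) → trans (⟦⟧≈difference (a ℕ.* c ℕ.+ b ℕ.* d) (a ℕ.* d ℕ.+ b ℕ.* c)) (trans (difference-* a b c d)
                                         (sym (*-cong (⟦⟧≈difference a b) (⟦⟧≈difference c d)))) }
      ; -‿homo = λ { (a , b) → trans (⟦⟧≈difference b a) (trans (difference-swap a b) (-‿cong (sym (⟦⟧≈difference a b)))) }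
      ; 0-homo = refl
      ; 1-homo = refl
      }
      where
      difference-swap : ∀ a b → difference (b , a) ≈ - difference (a , b)
      difference-swap a b = begin
        b · 1# - a · 1#            ≈⟨ +-comm _ _ ⟩
        - (a · 1#) + b · 1#        ≈⟨ +-congˡ (sym (-‿involutive _)) ⟩
        - (a · 1#) + - - (b · 1#)  ≈⟨ ⁻¹-∙-comm _ _ ⟩
        - (a · 1# - b · 1#)        ∎

    ⟦⟧-equal? : ∀ x y → Maybe (⟦ x ⟧ ≈ ⟦ y ⟧)
    ⟦⟧-equal? (a , b) (c , d) with a ℕ.+ d ℕ.≟ c ℕ.+ b
    ... | no _  = nothing
    ... | yes e = just (trans (⟦⟧≈difference a b) (trans (begin
      A - B                    ≈⟨ sym (+-identityʳ _) ⟩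
      (A - B) + 0#             ≈⟨ +-congˡ (sym (-‿inverseʳ D)) ⟩
      (A + - B) + (D + - D)    ≈⟨ interchange A (- B) D (- D) ⟩
      (A + D) + (- B + - D)    ≈⟨ +-congʳ (trans (sym (×-homo-+ 1# a d)) (trans (×-congˡ e) (×-homo-+ 1# c b))) ⟩
      (C + B) + (- B + - D)    ≈⟨ +-assoc C B _ ⟩
      C + (B + (- B + - D))    ≈⟨ +-congˡ (sym (+-assoc B (- B) (- D))) ⟩
      C + ((B - B) + - D)      ≈⟨ +-congˡ (+-congʳ (-‿inverseʳ B)) ⟩
      C + (0# + - D)           ≈⟨ +-congˡ (+-identityˡ _) ⟩
      C - D                    ∎) (sym (⟦⟧≈difference c d))))
      where A = a · 1#; B = b · 1#; C = c · 1#; D = d · 1#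

  open import Algebra.Solver.Ring ℕ²-rawRing (fromCommutativeRing R) ⟦⟧-homomorphism ⟦⟧-equal? public
    using (solve; _:=_; _:+_; _:*_; _:-_; :-_; con)

module FiniteSums {ℓ₁ ℓ₂} (R : CommutativeRing ℓ₁ ℓ₂) where
  open CommutativeRing R hiding (zero)
  open IntegerCoefficientSolver R
  open import Algebra.Definitions.RawSemiring (Semiring.rawSemiring semiring) using (_^_)
  open import Algebra.Properties.Ring ring using (-‿distribˡ-*; -0#≈0#)
  open import Algebra.Properties.AbelianGroup +-abelianGroup using (⁻¹-∙-comm)
  open import Algebra.Properties.CommutativeSemigroup +-commutativeSemigroup using (interchange)
  open import Algebra.Properties.CommutativeSemigroup *-commutativeSemigroup using () renaming (interchange to *-interchange)
  open import Relation.Binary.Reasoning.Setoid setoid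

  Σ< Π< : ℕ → (ℕ → Carrier) → Carrier
  Σ< = sumTo R
  Π< = prodTo R

  sum-cong-< : ∀ n {f g : ℕ → Carrier} → (∀ i → i < n → f i ≈ g i) → Σ< n f ≈ Σ< n g
  sum-cong-< zero    f≈g = refl
  sum-cong-< (suc n) f≈g = +-cong (sum-cong-< n (λ i i<n → f≈g i (ℕ.m<n⇒m<1+n i<n))) (f≈g n (ℕ.n<1+n n))

  sum-cong : ∀ n {f g : ℕ → Carrier} → (∀ i → f i ≈ g i) → Σ< n f ≈ Σ< n g
  sum-cong n f≈g = sum-cong-< n (λ i _ → f≈g i)

  sum-zero : ∀ n {f : ℕ → Carrier} → (∀ i → i < n → f i ≈ 0#) → Σ< n f ≈ 0#
  sum-zero zero    f≈0 = refl
  sum-zero (suc n) f≈0 =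
    trans (+-cong (sum-zero n (λ i i<n → f≈0 i (ℕ.m<n⇒m<1+n i<n))) (f≈0 n (ℕ.n<1+n n))) (+-identityˡ 0#)

  sum-+ : ∀ n (f g : ℕ → Carrier) → Σ< n (λ i → f i + g i) ≈ Σ< n f + Σ< n g
  sum-+ zero    f g = sym (+-identityˡ 0#)
  sum-+ (suc n) f g = trans (+-congʳ (sum-+ n f g)) (interchange (Σ< n f) (Σ< n g) (f n) (g n))

  sum-*ˡ : ∀ n x (f : ℕ → Carrier) → x * Σ< n f ≈ Σ< n (λ i → x * f i)
  sum-*ˡ zero    x f = zeroʳ x
  sum-*ˡ (suc n) x f = trans (distribˡ x _ _) (+-congʳ (sum-*ˡ n x f))

  sum-*ʳ : ∀ n x (f : ℕ → Carrier) → Σ< n f * x ≈ Σ< n (λ i → f i * x)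
  sum-*ʳ n x f = trans (*-comm _ x) (trans (sum-*ˡ n x f) (sum-cong n (λ i → *-comm x (f i))))

  sum-neg : ∀ n (f : ℕ → Carrier) → - Σ< n f ≈ Σ< n (λ i → - f i)
  sum-neg zero    f = -0#≈0#
  sum-neg (suc n) f = trans (sym (⁻¹-∙-comm _ _)) (+-congʳ (sum-neg n f))

  sum-- : ∀ n (f g : ℕ → Carrier) → Σ< n (λ i → f i - g i) ≈ Σ< n f - Σ< n g
  sum-- n f g = trans (sum-+ n f (λ i → - g i)) (+-congˡ (sym (sum-neg n g)))

  sum-swap : ∀ n m (f : ℕ → ℕ → Carrier) → Σ< n (λ i → Σ< m (f i)) ≈ Σ< m (λ j → Σ< n (λ i → f i j))
  sum-swap zero    m f = sym (sum-zero m (λ _ _ → refl))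
  sum-swap (suc n) m f = trans (+-congʳ (sum-swap n m f)) (sym (sum-+ m (λ j → Σ< n (λ i → f i j)) (f n)))

  sum-split : ∀ a b (f : ℕ → Carrier) → Σ< (a ℕ.+ b) f ≈ Σ< a f + Σ< b (λ i → f (a ℕ.+ i))
  sum-split a zero    f rewrite ℕ.+-identityʳ a = sym (+-identityʳ _)
  sum-split a (suc b) f rewrite ℕ.+-suc a b = trans (+-congʳ (sum-split a b f)) (+-assoc _ _ _)

  sum-head : ∀ n (f : ℕ → Carrier) → Σ< (suc n) f ≈ f 0 + Σ< n (λ i → f (suc i))
  sum-head n f = trans (sum-split 1 n f) (+-congʳ (+-identityˡ (f 0)))

  sum-extend : ∀ {n m} (f : ℕ → Carrier) → n ≤ m → (∀ i → n ≤ i → i < m → f i ≈ 0#) → Σ< m f ≈ Σ< n f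
  sum-extend {n} f n≤m f≈0 with ℕ.m≤n⇒∃[o]m+o≡n n≤m
  ... | k , ≡.refl = trans (sum-split n k f) (trans (+-congˡ tail≈0) (+-identityʳ _))
    where
    tail≈0 : Σ< k (λ i → f (n ℕ.+ i)) ≈ 0#
    tail≈0 = sum-zero k (λ i i<k → f≈0 (n ℕ.+ i) (ℕ.m≤m+n n i) (ℕ.+-monoʳ-< n i<k))

  sum-reverse : ∀ n (f : ℕ → Carrier) → Σ< n f ≈ Σ< n (λ i → f (n ∸ suc i))
  sum-reverse zero    f = refl
  sum-reverse (suc n) f = begin
    Σ< n f + f n                                       ≈⟨ +-comm _ _ ⟩
    f n + Σ< n f                                       ≈⟨ +-congˡ (sum-reverse n f) ⟩
    f (suc n ∸ 1) + Σ< n (λ i → f (suc n ∸ suc (suc i))) ≈⟨ sym (sum-head n (λ i → f (suc n ∸ suc i))) ⟩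
    Σ< (suc n) (λ i → f (suc n ∸ suc i))                ∎

  prod-cong-< : ∀ n {f g : ℕ → Carrier} → (∀ i → i < n → f i ≈ g i) → Π< n f ≈ Π< n g
  prod-cong-< zero    f≈g = refl
  prod-cong-< (suc n) f≈g = *-cong (prod-cong-< n (λ i i<n → f≈g i (ℕ.m<n⇒m<1+n i<n))) (f≈g n (ℕ.n<1+n n))

  prod-cong : ∀ n {f g : ℕ → Carrier} → (∀ i → f i ≈ g i) → Π< n f ≈ Π< n g
  prod-cong n f≈g = prod-cong-< n (λ i _ → f≈g i)

  prod-* : ∀ n (f g : ℕ → Carrier) → Π< n (λ i → f i * g i) ≈ Π< n f * Π< n g
  prod-* zero    f g = sym (*-identityˡ 1#)
  prod-* (suc n) f g = trans (*-congʳ (prod-* n f g)) (*-interchange (Π< n f) (Π< n g) (f n) (g n))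

  prod-split : ∀ a b (f : ℕ → Carrier) → Π< (a ℕ.+ b) f ≈ Π< a f * Π< b (λ i → f (a ℕ.+ i))
  prod-split a zero    f rewrite ℕ.+-identityʳ a = sym (*-identityʳ _)
  prod-split a (suc b) f rewrite ℕ.+-suc a b = trans (*-congʳ (prod-split a b f)) (*-assoc _ _ _)

  prod-head : ∀ n (f : ℕ → Carrier) → Π< (suc n) f ≈ f 0 * Π< n (λ i → f (suc i))
  prod-head n f = trans (prod-split 1 n f) (*-congʳ (*-identityˡ (f 0)))

  prod-reverse : ∀ n (f : ℕ → Carrier) → Π< n f ≈ Π< n (λ i → f (n ∸ suc i))
  prod-reverse zero    f = refl
  prod-reverse (suc n) f = begin
    Π< n f * f n                                       ≈⟨ *-comm _ _ ⟩
    f n * Π< n f                                       ≈⟨ *-congˡ (prod-reverse n f) ⟩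
    f (suc n ∸ 1) * Π< n (λ i → f (suc n ∸ suc (suc i))) ≈⟨ sym (prod-head n (λ i → f (suc n ∸ suc i))) ⟩
    Π< (suc n) (λ i → f (suc n ∸ suc i))                ∎

  sgn-+ : ∀ a b → sgn R (a ℕ.+ b) ≈ sgn R a * sgn R b
  sgn-+ zero    b = sym (*-identityˡ _)
  sgn-+ (suc a) b = trans (-‿cong (sgn-+ a b)) (-‿distribˡ-* _ _)

  sgn*sgn : ∀ a → sgn R a * sgn R a ≈ 1#
  sgn*sgn zero    = *-identityˡ 1#
  sgn*sgn (suc a) = trans (solve 1 (λ x → (:- x) :* (:- x) := x :* x) refl (sgn R a)) (sgn*sgn a)

  1^n≈1 : ∀ n → 1# ^ n ≈ 1#
  1^n≈1 zero    = refl
  1^n≈1 (suc n) = trans (*-identityˡ _) (1^n≈1 n)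

-- tri lives in the R-parametrised block of Defs but does not depend on R.
module TriangularNumbers {ℓ₁ ℓ₂} (R : CommutativeRing ℓ₁ ℓ₂) where
  tri-pred : ∀ t → tri R t ≡ t ℕ.+ tri R (t ∸ 1)
  tri-pred zero    = ≡.refl
  tri-pred (suc t) = ≡.refl

  tri-double : ∀ n → tri R n ℕ.+ tri R n ≡ n ℕ.* suc n
  tri-double zero    = ≡.refl
  tri-double (suc n) = ≡.trans (regroup n (tri R n)) (≡.trans (≡.cong (λ z → suc n ℕ.+ suc n ℕ.+ z) (tri-double n)) (close n))
    where
    regroup : ∀ n t → suc n ℕ.+ t ℕ.+ (suc n ℕ.+ t) ≡ suc n ℕ.+ suc n ℕ.+ (t ℕ.+ t)
    regroup = solve-∀
    close : ∀ n → suc n ℕ.+ suc n ℕ.+ n ℕ.* suc n ≡ suc n ℕ.* suc (suc n)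
    close = solve-∀

  tri-+ : ∀ a b → tri R (a ℕ.+ b) ≡ tri R a ℕ.+ tri R b ℕ.+ a ℕ.* b
  tri-+ zero    b = ≡.sym (ℕ.+-identityʳ (tri R b))
  tri-+ (suc a) b = ≡.trans (≡.cong (suc (a ℕ.+ b) ℕ.+_) (tri-+ a b)) (regroup a b (tri R a) (tri R b))
    where
    regroup : ∀ a b x y → suc (a ℕ.+ b) ℕ.+ (x ℕ.+ y ℕ.+ a ℕ.* b) ≡ suc a ℕ.+ x ℕ.+ y ℕ.+ suc a ℕ.* b
    regroup = solve-∀

module GaussianBinomials {ℓ₁ ℓ₂} (R : CommutativeRing ℓ₁ ℓ₂) (q : CommutativeRing.Carrier R) where
  open CommutativeRing R hiding (zero)
  open import Algebra.Definitions.RawSemiring (Semiring.rawSemiring semiring) using (_^_)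
  open import Algebra.Properties.Semiring.Exp semiring using (^-homo-*; ^-congʳ)
  open IntegerCoefficientSolver R
  open FiniteSums R
  open import Relation.Binary.Reasoning.Setoid setoid

  [_,_] : ℕ → ℕ → Carrier
  [ n , k ] = gauss R q n k

  poch : ℕ → ℕ → Carrier
  poch a k = Π< k (λ j → 1# - q ^ (a ℕ.+ j))

  gauss≈0 : ∀ {n k} → n < k → [ n , k ] ≈ 0#
  gauss≈0 {zero}  {suc k} _         = refl
  gauss≈0 {suc n} {suc k} (s≤s n<k) = begin
    [ n , k ] + q ^ suc k * [ n , suc k ] ≈⟨ +-cong (gauss≈0 n<k) (*-congˡ (gauss≈0 (ℕ.m<n⇒m<1+n n<k))) ⟩
    0# + q ^ suc k * 0#                   ≈⟨ trans (+-identityˡ _) (zeroʳ _) ⟩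
    0#                                    ∎

  gauss-diagonal : ∀ n → [ n , n ] ≈ 1#
  gauss-diagonal zero    = refl
  gauss-diagonal (suc n) = begin
    [ n , n ] + q ^ suc n * [ n , suc n ] ≈⟨ +-cong (gauss-diagonal n) (*-congˡ (gauss≈0 (ℕ.n<1+n n))) ⟩
    1# + q ^ suc n * 0#                   ≈⟨ trans (+-congˡ (zeroʳ _)) (+-identityʳ 1#) ⟩
    1#                                    ∎

  poch-split : ∀ a k l → poch a (k ℕ.+ l) ≈ poch a k * poch (a ℕ.+ k) l
  poch-split a k l = trans (prod-split k l _)
    (*-congˡ (prod-cong l (λ i → +-congˡ (-‿cong (^-congʳ q (≡.sym (ℕ.+-assoc a k i)))))))

  poch-head : ∀ a k → poch a (suc k) ≈ (1# - q ^ a) * poch (suc a) k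
  poch-head a k = trans (prod-head k _)
    (*-cong (+-congˡ (-‿cong (^-congʳ q (ℕ.+-identityʳ a)))) (prod-cong k (λ i → +-congˡ (-‿cong (^-congʳ q (ℕ.+-suc a i))))))

  gauss*poch-index : ∀ k a → [ k ℕ.+ a , k ] * poch 1 k ≈ poch (suc a) k
  gauss*poch-index zero    a       = *-identityˡ 1#
  gauss*poch-index (suc k) zero    = begin
    ([ k ℕ.+ 0 , k ] + u * [ k ℕ.+ 0 , suc k ]) * (poch 1 k * (1# - u))
      ≈⟨ *-congʳ (+-congˡ (*-congˡ (gauss≈0 (s≤s (ℕ.≤-reflexive (ℕ.+-identityʳ k)))))) ⟩
    ([ k ℕ.+ 0 , k ] + u * 0#) * (poch 1 k * (1# - u))
      ≈⟨ solve 4 (λ X u Q w → (X :+ u :* con (0 , 0)) :* (Q :* w) := (X :* Q) :* w) refl _ u _ _ ⟩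
    ([ k ℕ.+ 0 , k ] * poch 1 k) * (1# - u) ≈⟨ *-congʳ (gauss*poch-index k 0) ⟩
    poch 1 k * (1# - u)                     ∎
    where u = q ^ suc k
  gauss*poch-index (suc k) (suc a) = begin
    (X + u * Y) * (Q * (1# - u))
      ≈⟨ solve 4 (λ X Y Q u → (X :+ u :* Y) :* (Q :* (con (1 , 0) :- u))
                             := (X :* Q) :* (con (1 , 0) :- u) :+ u :* (Y :* (Q :* (con (1 , 0) :- u)))) refl X Y Q u ⟩
    (X * Q) * (1# - u) + u * (Y * (Q * (1# - u)))          ≈⟨ +-cong (*-congʳ (gauss*poch-index k (suc a))) (*-congˡ Y*Q′≈) ⟩
    P * (1# - u) + u * ((1# - q ^ suc a) * P)
      ≈⟨ solve 3 (λ P u v → P :* (con (1 , 0) :- u) :+ u :* ((con (1 , 0) :- v) :* P) := P :* (con (1 , 0) :- u :* v)) refl P u (q ^ suc a) ⟩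
    P * (1# - u * q ^ suc a)                                ≈⟨ *-congˡ (+-congˡ (-‿cong (trans (sym (^-homo-* q (suc k) (suc a))) (^-congʳ q exponent)))) ⟩
    poch (suc (suc a)) (suc k)                              ∎
    where
    X = [ k ℕ.+ suc a , k ]; Y = [ k ℕ.+ suc a , suc k ]; Q = poch 1 k; u = q ^ suc k; P = poch (suc (suc a)) k
    exponent : suc k ℕ.+ suc a ≡ suc (suc a) ℕ.+ k
    exponent = ≡.trans (≡.cong suc (ℕ.+-suc k a)) (≡.cong (λ z → suc (suc z)) (ℕ.+-comm k a))
    Y*Q′≈ : Y * poch 1 (suc k) ≈ (1# - q ^ suc a) * P
    Y*Q′≈ = begin
      Y * poch 1 (suc k)                    ≈⟨ *-congʳ (reflexive (≡.cong (λ n → [ n , suc k ]) (ℕ.+-suc k a))) ⟩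
      [ suc k ℕ.+ a , suc k ] * poch 1 (suc k) ≈⟨ gauss*poch-index (suc k) a ⟩
      poch (suc a) (suc k)                  ≈⟨ poch-head (suc a) k ⟩
      (1# - q ^ suc a) * P                  ∎

  gauss*poch-coindex : ∀ k a → [ k ℕ.+ a , k ] * poch 1 a ≈ poch (suc k) a
  gauss*poch-coindex zero    a       = *-identityˡ _
  gauss*poch-coindex (suc k) zero    = begin
    ([ k ℕ.+ 0 , k ] + q ^ suc k * [ k ℕ.+ 0 , suc k ]) * 1#
      ≈⟨ *-congʳ (+-congˡ (*-congˡ (gauss≈0 (s≤s (ℕ.≤-reflexive (ℕ.+-identityʳ k)))))) ⟩
    ([ k ℕ.+ 0 , k ] + q ^ suc k * 0#) * 1#
      ≈⟨ solve 2 (λ X u → (X :+ u :* con (0 , 0)) :* con (1 , 0) := X :* con (1 , 0)) refl _ _ ⟩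
    [ k ℕ.+ 0 , k ] * 1#                                ≈⟨ gauss*poch-coindex k 0 ⟩
    1#                                                  ∎
  gauss*poch-coindex (suc k) (suc a) = begin
    (X + u * Y) * (Q * (1# - w))
      ≈⟨ solve 5 (λ X Y Q u w → (X :+ u :* Y) :* (Q :* (con (1 , 0) :- w))
                               := X :* (Q :* (con (1 , 0) :- w)) :+ u :* (Y :* Q) :* (con (1 , 0) :- w)) refl X Y Q u w ⟩
    X * (Q * (1# - w)) + u * (Y * Q) * (1# - w)         ≈⟨ +-cong X*Q′≈ (*-congʳ (*-congˡ Y*Q≈)) ⟩
    (1# - u) * P + u * P * (1# - w)
      ≈⟨ solve 3 (λ P u w → (con (1 , 0) :- u) :* P :+ u :* P :* (con (1 , 0) :- w) := P :* (con (1 , 0) :- u :* w)) refl P u w ⟩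
    P * (1# - u * w)                                    ≈⟨ *-congˡ (+-congˡ (-‿cong (trans (sym (^-homo-* q (suc k) (suc a))) (^-congʳ q exponent)))) ⟩
    poch (suc (suc k)) (suc a)                          ∎
    where
    X = [ k ℕ.+ suc a , k ]; Y = [ k ℕ.+ suc a , suc k ]; Q = poch 1 a; u = q ^ suc k; w = q ^ suc a
    P = poch (suc (suc k)) a
    exponent : suc k ℕ.+ suc a ≡ suc (suc k) ℕ.+ a
    exponent = ≡.cong suc (ℕ.+-suc k a)
    X*Q′≈ : X * poch 1 (suc a) ≈ (1# - u) * P
    X*Q′≈ = trans (gauss*poch-coindex k (suc a)) (poch-head (suc k) a)
    Y*Q≈ : Y * Q ≈ P
    Y*Q≈ = trans (*-congʳ (reflexive (≡.cong (λ n → [ n , suc k ]) (ℕ.+-suc k a)))) (gauss*poch-coindex (suc k) a)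

  gauss-factorial : ∀ k a → [ k ℕ.+ a , k ] * poch 1 k * poch 1 a ≈ poch 1 (k ℕ.+ a)
  gauss-factorial k a = begin
    [ k ℕ.+ a , k ] * poch 1 k * poch 1 a ≈⟨ *-congʳ (gauss*poch-index k a) ⟩
    poch (suc a) k * poch 1 a             ≈⟨ *-comm _ _ ⟩
    poch 1 a * poch (1 ℕ.+ a) k           ≈⟨ sym (poch-split 1 a k) ⟩
    poch 1 (a ℕ.+ k)                      ≈⟨ reflexive (≡.cong (poch 1) (ℕ.+-comm a k)) ⟩
    poch 1 (k ℕ.+ a)                      ∎

  gauss-ratio : ∀ a b → (1# - q ^ (a ∸ b)) * [ a , b ] ≈ (1# - q ^ suc b) * [ a , suc b ]
  gauss-ratio zero b = begin
    (1# - q ^ (0 ∸ b)) * [ 0 , b ] ≈⟨ *-congʳ (trans (+-congˡ (-‿cong (^-congʳ q (ℕ.0∸n≡0 b)))) (-‿inverseʳ 1#)) ⟩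
    0# * [ 0 , b ]                 ≈⟨ zeroˡ _ ⟩
    0#                             ≈⟨ sym (zeroʳ _) ⟩
    (1# - q ^ suc b) * 0#          ∎
  gauss-ratio (suc a) zero = begin
    (1# - q * q ^ a) * 1#                        ≈⟨ solve 2 (λ q x → (con (1 , 0) :- q :* x) :* con (1 , 0)
                                                             := (con (1 , 0) :- q) :+ q :* ((con (1 , 0) :- x) :* con (1 , 0))) refl q (q ^ a) ⟩
    (1# - q) + q * ((1# - q ^ a) * 1#)           ≈⟨ +-congˡ (*-congˡ (gauss-ratio a zero)) ⟩
    (1# - q) + q * ((1# - q ^ 1) * [ a , 1 ])    ≈⟨ solve 2 (λ q g → (con (1 , 0) :- q) :+ q :* ((con (1 , 0) :- q :* con (1 , 0)) :* g)
                                                             := (con (1 , 0) :- q :* con (1 , 0)) :* (con (1 , 0) :+ (q :* con (1 , 0)) :* g)) refl q [ a , 1 ] ⟩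
    (1# - q ^ 1) * (1# + q ^ 1 * [ a , 1 ])      ∎
  gauss-ratio (suc a) (suc b) with b ℕ.<? a
  ... | no  b≮a = begin
    (1# - q ^ (a ∸ b)) * [ suc a , suc b ]           ≈⟨ *-congʳ (trans (+-congˡ (-‿cong (^-congʳ q (ℕ.m≤n⇒m∸n≡0 a≤b)))) (-‿inverseʳ 1#)) ⟩
    0# * [ suc a , suc b ]                           ≈⟨ zeroˡ _ ⟩
    0#                                               ≈⟨ sym (trans (*-congˡ (gauss≈0 (s≤s (s≤s a≤b)))) (zeroʳ _)) ⟩
    (1# - q ^ suc (suc b)) * [ suc a , suc (suc b) ] ∎
    where a≤b = ℕ.≮⇒≥ b≮a
  ... | yes b<a = begin
    (1# - q ^ (a ∸ b)) * (X + u * Y)           ≈⟨ *-congʳ (+-congˡ (-‿cong (^-congʳ q a∸b≡))) ⟩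
    (1# - q * v) * (X + u * Y)                 ≈⟨ solve 5 (λ q v X u Y → (con (1 , 0) :- q :* v) :* (X :+ u :* Y)
                                                              := (con (1 , 0) :- q :* v) :* X :+ (con (1 , 0) :- q :* v) :* u :* Y) refl q v X u Y ⟩
    (1# - q * v) * X + (1# - q * v) * u * Y    ≈⟨ +-congʳ (trans (*-congʳ (+-congˡ (-‿cong (^-congʳ q (≡.sym a∸b≡))))) (gauss-ratio a b)) ⟩
    (1# - u) * Y + (1# - q * v) * u * Y        ≈⟨ solve 4 (λ q v u Y → (con (1 , 0) :- u) :* Y :+ (con (1 , 0) :- q :* v) :* u :* Y
                                                              := (con (1 , 0) :- q :* u) :* Y :+ q :* u :* ((con (1 , 0) :- v) :* Y)) refl q v u Y ⟩
    (1# - q * u) * Y + q * u * ((1# - v) * Y)  ≈⟨ +-congˡ (*-congˡ (gauss-ratio a (suc b))) ⟩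
    (1# - q * u) * Y + q * u * ((1# - q * u) * Z) ≈⟨ solve 4 (λ q u Y Z → (con (1 , 0) :- q :* u) :* Y :+ q :* u :* ((con (1 , 0) :- q :* u) :* Z)
                                                              := (con (1 , 0) :- q :* u) :* (Y :+ q :* u :* Z)) refl q u Y Z ⟩
    (1# - q * u) * (Y + q * u * Z)             ∎
    where
    X = [ a , b ]; Y = [ a , suc b ]; Z = [ a , suc (suc b) ]; u = q ^ suc b; v = q ^ (a ∸ suc b)
    a∸b≡ : a ∸ b ≡ suc (a ∸ suc b)
    a∸b≡ = ℕ.+-∸-assoc 1 b<a

  gauss-pascal′ : ∀ a b → [ suc a , suc b ] ≈ q ^ (a ∸ b) * [ a , b ] + [ a , suc b ]
  gauss-pascal′ a b = begin
    X + u * Y                          ≈⟨ solve 4 (λ X Y u w → X :+ u :* Y := w :* X :+ ((con (1 , 0) :- w) :* X :+ u :* Y)) refl X Y u w ⟩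
    w * X + ((1# - w) * X + u * Y)     ≈⟨ +-congˡ (+-congʳ (gauss-ratio a b)) ⟩
    w * X + ((1# - u) * Y + u * Y)     ≈⟨ +-congˡ (solve 2 (λ u Y → (con (1 , 0) :- u) :* Y :+ u :* Y := Y) refl u Y) ⟩
    w * X + Y                          ∎
    where X = [ a , b ]; Y = [ a , suc b ]; u = q ^ suc b; w = q ^ (a ∸ b)

  gauss-symmetric : ∀ k a → [ k ℕ.+ a , k ] ≈ [ k ℕ.+ a , a ]
  gauss-symmetric zero    a       = sym (gauss-diagonal a)
  gauss-symmetric (suc k) zero    = trans (reflexive (≡.cong (λ n → [ n , suc k ]) (ℕ.+-identityʳ (suc k)))) (gauss-diagonal (suc k))
  gauss-symmetric (suc k) (suc a) = begin
    [ k ℕ.+ suc a , k ] + q ^ suc k * [ k ℕ.+ suc a , suc k ] ≈⟨ +-cong (gauss-symmetric k (suc a)) (*-congˡ shifted) ⟩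
    [ k ℕ.+ suc a , suc a ] + q ^ suc k * [ k ℕ.+ suc a , a ] ≈⟨ +-comm _ _ ⟩
    q ^ suc k * [ k ℕ.+ suc a , a ] + [ k ℕ.+ suc a , suc a ] ≈⟨ +-congʳ (*-congʳ (^-congʳ q (≡.sym k+1+a∸a≡))) ⟩
    q ^ ((k ℕ.+ suc a) ∸ a) * [ k ℕ.+ suc a , a ] + [ k ℕ.+ suc a , suc a ] ≈⟨ sym (gauss-pascal′ (k ℕ.+ suc a) a) ⟩
    [ suc (k ℕ.+ suc a) , suc a ] ∎
    where
    k+1+a∸a≡ : (k ℕ.+ suc a) ∸ a ≡ suc k
    k+1+a∸a≡ = ≡.trans (≡.cong (_∸ a) (ℕ.+-suc k a)) (ℕ.m+n∸n≡m (suc k) a)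
    shifted : [ k ℕ.+ suc a , suc k ] ≈ [ k ℕ.+ suc a , a ]
    shifted = ≡.subst (λ n → [ n , suc k ] ≈ [ n , a ]) (≡.sym (ℕ.+-suc k a)) (gauss-symmetric (suc k) a)

module ChuVandermonde {ℓ₁ ℓ₂} (R : CommutativeRing ℓ₁ ℓ₂) (q : CommutativeRing.Carrier R) where
  open CommutativeRing R hiding (zero)
  open import Algebra.Definitions.RawSemiring (Semiring.rawSemiring semiring) using (_^_)
  open import Algebra.Properties.Semiring.Exp semiring using (^-homo-*; ^-congʳ)
  open IntegerCoefficientSolver R
  open FiniteSums R
  open GaussianBinomials R q
  open import Relation.Binary.Reasoning.Setoid setoid

  chuTerm : ℕ → ℕ → ℕ → Carrier
  chuTerm M c k = q ^ (c ℕ.* k ℕ.+ k ℕ.* k) * [ M , k ] * poch (k ℕ.+ c ℕ.+ 1) (M ∸ k)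

  chuSum : ℕ → ℕ → Carrier
  chuSum M c = Σ< (suc M) (chuTerm M c)

  private
    raised extended : ℕ → ℕ → ℕ → Carrier
    raised   M c k = q ^ ((2 ℕ.+ c) ℕ.* k ℕ.+ k ℕ.* k) * [ M , k ] * poch (suc (k ℕ.+ c ℕ.+ 1)) (M ∸ k)
    extended M c k = q ^ (c ℕ.* k ℕ.+ k ℕ.* k ℕ.+ k) * [ M , k ] * poch (k ℕ.+ c ℕ.+ 1) (suc M ∸ k)

    chuTerm-pascal : ∀ M c j → chuTerm (suc M) c (suc j) ≈ q ^ suc c * raised M c j + extended M c (suc j)
    chuTerm-pascal M c j = begin
      x * ([ M , j ] + u * [ M , suc j ]) * P     ≈⟨ solve 5 (λ x X u Y P → x :* (X :+ u :* Y) :* P := x :* X :* P :+ x :* u :* Y :* P) refl x _ u _ P ⟩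
      x * [ M , j ] * P + x * u * [ M , suc j ] * P ≈⟨ +-cong (*-congʳ (*-congʳ x≈)) (*-congʳ (*-congʳ (sym (^-homo-* q (c ℕ.* suc j ℕ.+ suc j ℕ.* suc j) (suc j))))) ⟩
      (q ^ suc c * y) * [ M , j ] * P + extended M c (suc j) ≈⟨ +-congʳ (solve 4 (λ a b X P → (a :* b) :* X :* P := a :* (b :* X :* P)) refl _ y _ P) ⟩
      q ^ suc c * raised M c j + extended M c (suc j) ∎
      where
      x = q ^ (c ℕ.* suc j ℕ.+ suc j ℕ.* suc j); y = q ^ ((2 ℕ.+ c) ℕ.* j ℕ.+ j ℕ.* j); u = q ^ suc j
      P = poch (suc j ℕ.+ c ℕ.+ 1) (M ∸ j)
      exponent : ∀ c j → c ℕ.* suc j ℕ.+ suc j ℕ.* suc j ≡ suc c ℕ.+ ((2 ℕ.+ c) ℕ.* j ℕ.+ j ℕ.* j)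
      exponent = solve-∀
      x≈ : x ≈ q ^ suc c * y
      x≈ = trans (^-congʳ q (exponent c j)) (^-homo-* q (suc c) _)

    extended-split : ∀ M c k → k ≤ M → extended M c k ≈ chuTerm M (suc c) k - q ^ suc c * raised M c k
    extended-split M c k k≤M = begin
      x * [ M , k ] * poch (k ℕ.+ c ℕ.+ 1) (suc M ∸ k)
        ≈⟨ *-congˡ (trans (reflexive (≡.cong (poch (k ℕ.+ c ℕ.+ 1)) (ℕ.+-∸-assoc 1 k≤M))) (poch-head (k ℕ.+ c ℕ.+ 1) (M ∸ k))) ⟩
      x * [ M , k ] * ((1# - u) * P)
        ≈⟨ solve 4 (λ x X u P → x :* X :* ((con (1 , 0) :- u) :* P) := x :* X :* P :- (x :* u) :* X :* P) refl x _ u P ⟩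
      x * [ M , k ] * P - (x * u) * [ M , k ] * P
        ≈⟨ +-cong (*-cong (*-congʳ (^-congʳ q (exponent₁ c k))) (reflexive (≡.cong (λ a → poch a (M ∸ k)) (exponent₂ c k))))
                  (-‿cong (*-congʳ (*-congʳ x*u≈))) ⟩
      chuTerm M (suc c) k - (q ^ suc c * q ^ ((2 ℕ.+ c) ℕ.* k ℕ.+ k ℕ.* k)) * [ M , k ] * P
        ≈⟨ +-congˡ (-‿cong (solve 4 (λ a b X P → a :* b :* X :* P := a :* (b :* X :* P)) refl _ _ _ P)) ⟩
      chuTerm M (suc c) k - q ^ suc c * raised M c k ∎
      where
      x = q ^ (c ℕ.* k ℕ.+ k ℕ.* k ℕ.+ k); u = q ^ (k ℕ.+ c ℕ.+ 1); P = poch (suc (k ℕ.+ c ℕ.+ 1)) (M ∸ k)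
      exponent₁ : ∀ c k → c ℕ.* k ℕ.+ k ℕ.* k ℕ.+ k ≡ suc c ℕ.* k ℕ.+ k ℕ.* k
      exponent₁ = solve-∀
      exponent₂ : ∀ c k → suc (k ℕ.+ c ℕ.+ 1) ≡ k ℕ.+ suc c ℕ.+ 1
      exponent₂ = solve-∀
      exponent₃ : ∀ c k → (c ℕ.* k ℕ.+ k ℕ.* k ℕ.+ k) ℕ.+ (k ℕ.+ c ℕ.+ 1) ≡ suc c ℕ.+ ((2 ℕ.+ c) ℕ.* k ℕ.+ k ℕ.* k)
      exponent₃ = solve-∀
      x*u≈ : x * u ≈ q ^ suc c * q ^ ((2 ℕ.+ c) ℕ.* k ℕ.+ k ℕ.* k)
      x*u≈ = trans (sym (^-homo-* q (c ℕ.* k ℕ.+ k ℕ.* k ℕ.+ k) (k ℕ.+ c ℕ.+ 1)))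
                   (trans (^-congʳ q (exponent₃ c k)) (^-homo-* q (suc c) ((2 ℕ.+ c) ℕ.* k ℕ.+ k ℕ.* k)))

  chuSum-step : ∀ M c → chuSum (suc M) c ≈ chuSum M (suc c)
  chuSum-step M c = begin
    chuSum (suc M) c
      ≈⟨ sum-head (suc M) _ ⟩
    chuTerm (suc M) c 0 + Σ< (suc M) (λ j → chuTerm (suc M) c (suc j))
      ≈⟨ +-cong (*-congʳ (*-congʳ (^-congʳ q (≡.sym (ℕ.+-identityʳ (c ℕ.* 0 ℕ.+ 0)))))) (sum-cong (suc M) (chuTerm-pascal M c)) ⟩
    E 0 + Σ< (suc M) (λ j → q ^ suc c * raised M c j + E (suc j))
      ≈⟨ +-congˡ (trans (sum-+ (suc M) _ _) (+-congʳ (sym (sum-*ˡ (suc M) _ _)))) ⟩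
    E 0 + (q ^ suc c * Σr + Σ< (suc M) (λ j → E (suc j)))
      ≈⟨ solve 3 (λ a b c → a :+ (b :+ c) := b :+ (a :+ c)) refl _ _ _ ⟩
    q ^ suc c * Σr + (E 0 + Σ< (suc M) (λ j → E (suc j)))
      ≈⟨ +-congˡ (sym (sum-head (suc M) E)) ⟩
    q ^ suc c * Σr + Σ< (suc (suc M)) E
      ≈⟨ +-congˡ (sum-extend E (ℕ.n≤1+n (suc M)) (λ i M<i i<M+2 → E≈0 i M<i)) ⟩
    q ^ suc c * Σr + Σ< (suc M) E
      ≈⟨ +-congˡ (sum-cong-< (suc M) (λ k k<M+1 → extended-split M c k (ℕ.≤-pred k<M+1))) ⟩
    q ^ suc c * Σr + Σ< (suc M) (λ k → chuTerm M (suc c) k - q ^ suc c * raised M c k)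
      ≈⟨ +-congˡ (trans (sum-- (suc M) _ _) (+-congˡ (-‿cong (sym (sum-*ˡ (suc M) _ _))))) ⟩
    q ^ suc c * Σr + (chuSum M (suc c) - q ^ suc c * Σr)
      ≈⟨ solve 2 (λ x y → x :+ (y :- x) := y) refl _ _ ⟩
    chuSum M (suc c) ∎
    where
    E = extended M c
    Σr = Σ< (suc M) (raised M c)
    E≈0 : ∀ i → suc M ≤ i → E i ≈ 0#
    E≈0 i M<i = trans (*-congʳ (*-congˡ (gauss≈0 M<i))) (trans (*-congʳ (zeroʳ _)) (zeroˡ _))

  chuSum≈1 : ∀ M c → chuSum M c ≈ 1#
  chuSum≈1 zero    c = trans (+-identityˡ _) (trans (*-identityʳ _) (trans (*-identityʳ _) (^-congʳ q (≡.trans (ℕ.+-identityʳ (c ℕ.* 0)) (ℕ.*-zeroʳ c)))))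
  chuSum≈1 (suc M) c = trans (chuSum-step M c) (chuSum≈1 M (suc c))

module DiagonalSums {ℓ₁ ℓ₂} (R : CommutativeRing ℓ₁ ℓ₂) (q : CommutativeRing.Carrier R) where
  open CommutativeRing R hiding (zero)
  open import Algebra.Definitions.RawSemiring (Semiring.rawSemiring semiring) using (_^_)
  open import Algebra.Properties.Semiring.Exp semiring using (^-homo-*; ^-congʳ)
  open import Algebra.Properties.Ring ring using (-‿distribʳ-*; -0#≈0#)
  open IntegerCoefficientSolver R
  open FiniteSums R
  open GaussianBinomials R q
  open TriangularNumbers R
  open import Relation.Binary.Reasoning.Setoid setoid

  diagonal : (ℕ → Carrier) → ℕ → Carrier
  diagonal c n = Σ< (suc n) (λ i → c i * [ n ∸ i , i ])

  D E : ℕ → Carrier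
  D = diagonal (λ i → sgn R i * q ^ tri R (i ∸ 1))
  E = diagonal (λ i → sgn R i * q ^ tri R i)

  private
    diagonal-peel : ∀ c n → diagonal c (suc (suc n)) ≈ c 0 * 1# + Σ< (suc n) (λ t → c (suc t) * [ suc n ∸ t , suc t ])
    diagonal-peel c n = trans (sum-head (suc (suc n)) _) (+-congˡ (sum-extend _ (ℕ.n≤1+n (suc n)) top≈0))
      where
      top≈0 : ∀ i → suc n ≤ i → i < suc (suc n) → c (suc i) * [ suc n ∸ i , suc i ] ≈ 0#
      top≈0 i n<i _ = trans (*-congˡ (gauss≈0 (s≤s (ℕ.≤-trans (ℕ.m∸n≤m (suc n) i) n<i)))) (zeroʳ _)

    d e : ℕ → ℕ → Carrier
    d n i = sgn R i * q ^ tri R (i ∸ 1) * [ n ∸ i , i ]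
    e n i = sgn R i * q ^ tri R i * [ n ∸ i , i ]

  D-recurrence : ∀ n → D (suc (suc n)) ≈ E (suc n) - E n
  D-recurrence n = begin
    D (suc (suc n))                                          ≈⟨ diagonal-peel _ n ⟩
    (1# * 1#) * 1# + Σ< (suc n) (λ t → d (suc (suc n)) (suc t)) ≈⟨ +-cong (trans (*-identityʳ _) (*-identityʳ 1#)) (sum-cong-< (suc n) term) ⟩
    1# + Σ< (suc n) (λ t → - e n t + e (suc n) (suc t))       ≈⟨ +-congˡ (trans (sum-+ (suc n) _ _) (+-congʳ (sym (sum-neg (suc n) (e n))))) ⟩
    1# + (- E n + Σ< (suc n) (λ t → e (suc n) (suc t)))       ≈⟨ solve 3 (λ o a b → o :+ (:- a :+ b) := (o :+ b) :- a) refl 1# _ _ ⟩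
    (1# + Σ< (suc n) (λ t → e (suc n) (suc t))) - E n         ≈⟨ +-congʳ (trans (+-congʳ (sym (trans (*-identityʳ _) (*-identityʳ 1#)))) (sym (sum-head (suc n) (e (suc n))))) ⟩
    E (suc n) - E n                                          ∎
    where
    term : ∀ t → t < suc n → d (suc (suc n)) (suc t) ≈ - e n t + e (suc n) (suc t)
    term t t<n+1 = begin
      - sgn R t * q ^ tri R t * [ suc n ∸ t , suc t ]
        ≈⟨ *-congˡ (reflexive (≡.cong (λ m → [ m , suc t ]) (ℕ.+-∸-assoc 1 (ℕ.≤-pred t<n+1)))) ⟩
      - sgn R t * q ^ tri R t * ([ n ∸ t , t ] + q ^ suc t * [ n ∸ t , suc t ])
        ≈⟨ solve 5 (λ s x y u z → :- s :* x :* (y :+ u :* z) := :- (s :* x :* y) :+ :- s :* (u :* x) :* z) refl _ _ _ _ _ ⟩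
      - e n t + - sgn R t * (q ^ suc t * q ^ tri R t) * [ n ∸ t , suc t ]
        ≈⟨ +-congˡ (*-congʳ (*-congˡ (sym (^-homo-* q (suc t) (tri R t))))) ⟩
      - e n t + e (suc n) (suc t) ∎

  E-recurrence : ∀ n → E (suc (suc n)) ≈ E (suc n) - q ^ suc n * D n
  E-recurrence n = begin
    E (suc (suc n))                                           ≈⟨ diagonal-peel _ n ⟩
    e (suc n) 0 + Σ< (suc n) (λ t → e (suc (suc n)) (suc t))   ≈⟨ +-congˡ (sum-cong-< (suc n) term) ⟩
    e (suc n) 0 + Σ< (suc n) (λ t → - (q ^ suc n * d n t) + e (suc n) (suc t))
      ≈⟨ +-congˡ (trans (sum-+ (suc n) _ _) (+-congʳ (trans (sym (sum-neg (suc n) _)) (-‿cong (sym (sum-*ˡ (suc n) _ (d n))))))) ⟩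
    e (suc n) 0 + (- (q ^ suc n * D n) + Σ< (suc n) (λ t → e (suc n) (suc t)))
      ≈⟨ solve 3 (λ a b c → c :+ (:- a :+ b) := (c :+ b) :- a) refl _ _ _ ⟩
    (e (suc n) 0 + Σ< (suc n) (λ t → e (suc n) (suc t))) - q ^ suc n * D n ≈⟨ +-congʳ (sym (sum-head (suc n) (e (suc n)))) ⟩
    E (suc n) - q ^ suc n * D n                               ∎
    where
    term : ∀ t → t < suc n → e (suc (suc n)) (suc t) ≈ - (q ^ suc n * d n t) + e (suc n) (suc t)
    term t t<n+1 = begin
      - sgn R t * q ^ tri R (suc t) * [ suc n ∸ t , suc t ]
        ≈⟨ *-congˡ (trans (reflexive (≡.cong (λ m → [ m , suc t ]) (ℕ.+-∸-assoc 1 (ℕ.≤-pred t<n+1)))) (gauss-pascal′ (n ∸ t) t)) ⟩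
      - sgn R t * q ^ tri R (suc t) * (q ^ ((n ∸ t) ∸ t) * [ n ∸ t , t ] + [ n ∸ t , suc t ])
        ≈⟨ solve 5 (λ s x w y z → :- s :* x :* (w :* y :+ z) := :- (s :* (x :* w) :* y) :+ :- s :* x :* z) refl _ _ _ _ _ ⟩
      - (sgn R t * (q ^ tri R (suc t) * q ^ ((n ∸ t) ∸ t)) * [ n ∸ t , t ]) + e (suc n) (suc t)
        ≈⟨ +-congʳ (-‿cong shifted) ⟩
      - (q ^ suc n * d n t) + e (suc n) (suc t) ∎
      where
      exponent : t ℕ.+ t ≤ n → tri R (suc t) ℕ.+ ((n ∸ t) ∸ t) ≡ suc n ℕ.+ tri R (t ∸ 1)
      exponent 2t≤n = ≡.trans (≡.cong₂ (λ a b → suc t ℕ.+ a ℕ.+ b) (tri-pred t) (ℕ.∸-+-assoc n t t))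
        (≡.trans (regroup t (tri R (t ∸ 1)) (n ∸ (t ℕ.+ t))) (≡.cong (λ z → suc z ℕ.+ tri R (t ∸ 1)) (ℕ.m+[n∸m]≡n 2t≤n)))
        where
        regroup : ∀ t x r → suc t ℕ.+ (t ℕ.+ x) ℕ.+ r ≡ suc (t ℕ.+ t ℕ.+ r) ℕ.+ x
        regroup = solve-∀
      vanishing : ∀ t → n < t ℕ.+ t → [ n ∸ t , t ] ≈ 0#
      vanishing (suc t) n<2t = gauss≈0 (ℕ.m<n+o⇒m∸n<o n (suc t) n<2t)
      shifted : sgn R t * (q ^ tri R (suc t) * q ^ ((n ∸ t) ∸ t)) * [ n ∸ t , t ] ≈ q ^ suc n * d n t
      shifted with t ℕ.+ t ℕ.≤? n
      ... | yes 2t≤n = trans (*-congʳ (*-congˡ (trans (sym (^-homo-* q (tri R (suc t)) ((n ∸ t) ∸ t))) (trans (^-congʳ q (exponent 2t≤n)) (^-homo-* q (suc n) (tri R (t ∸ 1)))))))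
                             (solve 4 (λ s a b g → s :* (a :* b) :* g := a :* (s :* b :* g)) refl _ _ _ _)
      ... | no  2t≰n = trans (*-congˡ (vanishing t (ℕ.≰⇒> 2t≰n))) (trans (zeroʳ _)
                             (sym (trans (*-congˡ (trans (*-congˡ (vanishing t (ℕ.≰⇒> 2t≰n))) (zeroʳ _))) (zeroʳ _))))

  D-+3 : ∀ n → D (3 ℕ.+ n) ≈ - (q ^ suc n * D n)
  D-+3 n = trans (D-recurrence (suc n)) (trans (+-congʳ (E-recurrence n)) (solve 2 (λ a b → (a :- b) :- a := :- b) refl _ _))

  D-+6 : ∀ n → D (6 ℕ.+ n) ≈ q ^ (2 ℕ.* n ℕ.+ 5) * D n
  D-+6 n = begin
    D (6 ℕ.+ n)                               ≈⟨ D-+3 (3 ℕ.+ n) ⟩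
    - (q ^ (4 ℕ.+ n) * D (3 ℕ.+ n))           ≈⟨ -‿cong (*-congˡ (D-+3 n)) ⟩
    - (q ^ (4 ℕ.+ n) * - (q ^ suc n * D n))   ≈⟨ solve 3 (λ a b d → :- (a :* :- (b :* d)) := (a :* b) :* d) refl _ _ _ ⟩
    (q ^ (4 ℕ.+ n) * q ^ suc n) * D n         ≈⟨ *-congʳ (trans (sym (^-homo-* q (4 ℕ.+ n) (suc n))) (^-congʳ q (exponent n))) ⟩
    q ^ (2 ℕ.* n ℕ.+ 5) * D n                 ∎
    where
    exponent : ∀ n → 4 ℕ.+ n ℕ.+ suc n ≡ 2 ℕ.* n ℕ.+ 5
    exponent = solve-∀

  private
    D-shift6 : ∀ m {n} → n ≡ 6 ℕ.+ m → D n ≈ q ^ (2 ℕ.* m ℕ.+ 5) * D m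
    D-shift6 m ≡.refl = D-+6 m

    ^-merge : ∀ a b {c} → a ℕ.+ b ≡ c → q ^ a * q ^ b ≈ q ^ c
    ^-merge a b a+b≡c = trans (sym (^-homo-* q a b)) (^-congʳ q a+b≡c)

  D-6u+1 : ∀ u → D (6 ℕ.* u ℕ.+ 1) ≈ q ^ (6 ℕ.* u ℕ.* u ℕ.+ u)
  D-6u+1 zero    = solve 0 ((con (0 , 0) :+ con (1 , 0) :* con (1 , 0) :* con (1 , 0)) :+ (:- con (1 , 0)) :* con (1 , 0) :* con (0 , 0)
                            := con (1 , 0)) refl
  D-6u+1 (suc u) = trans (D-shift6 _ (index u)) (trans (*-congˡ (D-6u+1 u)) (^-merge (2 ℕ.* (6 ℕ.* u ℕ.+ 1) ℕ.+ 5) _ (exponent u)))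
    where
    index : ∀ u → 6 ℕ.* suc u ℕ.+ 1 ≡ 6 ℕ.+ (6 ℕ.* u ℕ.+ 1)
    index = solve-∀
    exponent : ∀ u → 2 ℕ.* (6 ℕ.* u ℕ.+ 1) ℕ.+ 5 ℕ.+ (6 ℕ.* u ℕ.* u ℕ.+ u) ≡ 6 ℕ.* suc u ℕ.* suc u ℕ.+ suc u
    exponent = solve-∀

  D-6u+3 : ∀ u → D (6 ℕ.* u ℕ.+ 3) ≈ - q ^ (6 ℕ.* u ℕ.* u ℕ.+ 5 ℕ.* u ℕ.+ 1)
  D-6u+3 zero    = trans (D-+3 0) (-‿cong (trans (*-congˡ D0≈1) (*-identityʳ _)))
    where
    D0≈1 : D 0 ≈ 1#
    D0≈1 = solve 0 (con (0 , 0) :+ con (1 , 0) :* con (1 , 0) :* con (1 , 0) := con (1 , 0)) refl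
  D-6u+3 (suc u) = trans (D-shift6 _ (index u))
    (trans (*-congˡ (D-6u+3 u)) (trans (sym (-‿distribʳ-* _ _)) (-‿cong (^-merge (2 ℕ.* (6 ℕ.* u ℕ.+ 3) ℕ.+ 5) _ (exponent u)))))
    where
    index : ∀ u → 6 ℕ.* suc u ℕ.+ 3 ≡ 6 ℕ.+ (6 ℕ.* u ℕ.+ 3)
    index = solve-∀
    exponent : ∀ u → 2 ℕ.* (6 ℕ.* u ℕ.+ 3) ℕ.+ 5 ℕ.+ (6 ℕ.* u ℕ.* u ℕ.+ 5 ℕ.* u ℕ.+ 1) ≡ 6 ℕ.* suc u ℕ.* suc u ℕ.+ 5 ℕ.* suc u ℕ.+ 1
    exponent = solve-∀

  D-6u+5 : ∀ u → D (6 ℕ.* u ℕ.+ 5) ≈ 0#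
  D-6u+5 zero    = trans (D-+3 2) (trans (-‿cong (trans (*-congˡ D2≈0) (zeroʳ _))) -0#≈0#)
    where
    D2≈0 : D 2 ≈ 0#
    D2≈0 = solve 1 (λ q → ((con (0 , 0) :+ con (1 , 0) :* con (1 , 0) :* con (1 , 0))
                           :+ (:- con (1 , 0)) :* con (1 , 0) :* (con (1 , 0) :+ (q :* con (1 , 0)) :* con (0 , 0)))
                           :+ (:- (:- con (1 , 0))) :* (q :* con (1 , 0)) :* con (0 , 0) := con (0 , 0)) refl q
  D-6u+5 (suc u) = trans (D-shift6 _ (index u)) (trans (*-congˡ (D-6u+5 u)) (zeroʳ _))
    where
    index : ∀ u → 6 ℕ.* suc u ℕ.+ 5 ≡ 6 ℕ.+ (6 ℕ.* u ℕ.+ 5)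
    index = solve-∀

  D-odd : ∀ N k → D (2 ℕ.* k ℕ.+ 1) ≈ βq R N q (k ℕ./ 3) (k ℕ.% 3)
  D-odd N k = by-residue (k ℕ.% 3) (k ℕ./ 3) (m%n<n k 3) (≡.cong (λ m → 2 ℕ.* m ℕ.+ 1) (m≡m%n+[m/n]*n k 3))
    where
    index : ∀ s u → 2 ℕ.* (s ℕ.+ u ℕ.* 3) ℕ.+ 1 ≡ 6 ℕ.* u ℕ.+ (2 ℕ.* s ℕ.+ 1)
    index = solve-∀
    by-residue : ∀ s u → s < 3 → 2 ℕ.* k ℕ.+ 1 ≡ 2 ℕ.* (s ℕ.+ u ℕ.* 3) ℕ.+ 1 → D (2 ℕ.* k ℕ.+ 1) ≈ βq R N q u s
    by-residue 0 u _ e = trans (reflexive (≡.cong D (≡.trans e (index 0 u)))) (D-6u+1 u)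
    by-residue 1 u _ e = trans (reflexive (≡.cong D (≡.trans e (index 1 u)))) (D-6u+3 u)
    by-residue 2 u _ e = trans (reflexive (≡.cong D (≡.trans e (index 2 u)))) (D-6u+5 u)
    by-residue (suc (suc (suc _))) _ (s≤s (s≤s (s≤s ()))) _

module UnitBaileyPair {ℓ₁ ℓ₂} (R : CommutativeRing ℓ₁ ℓ₂) (q : CommutativeRing.Carrier R) where
  open CommutativeRing R hiding (zero)
  open import Algebra.Definitions.RawSemiring (Semiring.rawSemiring semiring) using (_^_)
  open import Algebra.Properties.Semiring.Exp semiring using (^-homo-*; ^-congʳ)
  open IntegerCoefficientSolver R
  open FiniteSums R
  open GaussianBinomials R q
  open import Relation.Binary.Reasoning.Setoid setoid

  -- triGap i s = (s − i)(s − i + 1)/2, read in ℤ; it is a natural number also when i > s.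
  triGap : ℕ → ℕ → ℕ
  triGap zero    s       = tri R s
  triGap (suc i) zero    = tri R i
  triGap (suc i) (suc s) = triGap i s

  triGap-zero : ∀ i → triGap i 0 ℕ.+ i ≡ tri R i
  triGap-zero zero    = ≡.refl
  triGap-zero (suc i) = ℕ.+-comm (tri R i) (suc i)

  triGap-suc : ∀ i s → triGap i (suc s) ℕ.+ i ≡ triGap i s ℕ.+ suc s
  triGap-suc zero          s       = ≡.trans (ℕ.+-identityʳ _) (ℕ.+-comm (suc s) (tri R s))
  triGap-suc (suc zero)    zero    = ≡.refl
  triGap-suc (suc (suc i)) zero    = regroup (tri R i) i
    where
    regroup : ∀ t i → t ℕ.+ suc (suc i) ≡ suc i ℕ.+ t ℕ.+ 1
    regroup = solve-∀
  triGap-suc (suc i)       (suc s) = ≡.trans (ℕ.+-suc (triGap i (suc s)) i)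
    (≡.trans (≡.cong suc (triGap-suc i s)) (≡.sym (ℕ.+-suc (triGap i s) (suc s))))

  triGap-above : ∀ n r → triGap (n ℕ.+ r) n ≡ triGap r 0
  triGap-above zero    r = ≡.refl
  triGap-above (suc n) r = triGap-above n r

  triGap-below : ∀ a b → triGap a (a ℕ.+ b) ≡ tri R b
  triGap-below zero    b = ≡.refl
  triGap-below (suc a) b = triGap-below a b

  -- q^{s(s+1)/2} (q^{-s}; q)_a expanded by the q-binomial theorem; hence it vanishes for s < a.
  alternatingSum : ℕ → ℕ → Carrier
  alternatingSum a s = Σ< (suc a) (λ i → sgn R i * q ^ triGap i s * [ a , i ])

  alternatingSum-pascal : ∀ a s → alternatingSum (suc a) s ≈
    - Σ< (suc a) (λ j → sgn R j * q ^ triGap (suc j) s * [ a , j ]) + Σ< (suc a) (λ i → sgn R i * q ^ (triGap i s ℕ.+ i) * [ a , i ])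
  alternatingSum-pascal a s = begin
    alternatingSum (suc a) s
      ≈⟨ sum-head (suc a) _ ⟩
    t₀ + Σ< (suc a) (λ j → sgn R (suc j) * q ^ triGap (suc j) s * ([ a , j ] + q ^ suc j * [ a , suc j ]))
      ≈⟨ +-congˡ (trans (sum-cong (suc a) (λ j → solve 5 (λ s x g u h → (:- s) :* x :* (g :+ u :* h) := :- (s :* x :* g) :+ (:- s) :* (x :* u) :* h)
                                                          refl (sgn R j) (q ^ triGap (suc j) s) [ a , j ] (q ^ suc j) [ a , suc j ]))
                        (sum-+ (suc a) _ _)) ⟩
    t₀ + (Σ< (suc a) (λ j → - (sgn R j * q ^ triGap (suc j) s * [ a , j ])) + Σ< (suc a) (λ j → sgn R (suc j) * (q ^ triGap (suc j) s * q ^ suc j) * [ a , suc j ]))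
      ≈⟨ solve 3 (λ a b c → a :+ (b :+ c) := b :+ (a :+ c)) refl _ _ _ ⟩
    Σ< (suc a) (λ j → - (sgn R j * q ^ triGap (suc j) s * [ a , j ])) + (t₀ + Σ< (suc a) (λ j → sgn R (suc j) * (q ^ triGap (suc j) s * q ^ suc j) * [ a , suc j ]))
      ≈⟨ +-cong (sym (sum-neg (suc a) _)) (trans (+-cong t₀≈u₀ (sum-cong (suc a) (λ j → *-congʳ (*-congˡ (sym (^-homo-* q (triGap (suc j) s) (suc j)))))))
                                               (sym (sum-head (suc a) u))) ⟩
    - Σ< (suc a) (λ j → sgn R j * q ^ triGap (suc j) s * [ a , j ]) + Σ< (suc (suc a)) u
      ≈⟨ +-congˡ (trans (+-congˡ (trans (*-congˡ (gauss≈0 (ℕ.n<1+n a))) (zeroʳ _))) (+-identityʳ _)) ⟩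
    - Σ< (suc a) (λ j → sgn R j * q ^ triGap (suc j) s * [ a , j ]) + Σ< (suc a) u ∎
    where
    t₀ = sgn R 0 * q ^ triGap 0 s * [ suc a , 0 ]
    u : ℕ → Carrier
    u i = sgn R i * q ^ (triGap i s ℕ.+ i) * [ a , i ]
    t₀≈u₀ : t₀ ≈ u 0
    t₀≈u₀ = *-congʳ (*-congˡ (^-congʳ q (≡.sym (ℕ.+-identityʳ (triGap 0 s)))))

  alternatingSum-zero : ∀ a → alternatingSum (suc a) 0 ≈ 0#
  alternatingSum-zero a = begin
    alternatingSum (suc a) 0                 ≈⟨ alternatingSum-pascal a 0 ⟩
    - Σ< (suc a) f + Σ< (suc a) (λ i → sgn R i * q ^ (triGap i 0 ℕ.+ i) * [ a , i ])
      ≈⟨ +-congˡ (sum-cong (suc a) (λ i → *-congʳ (*-congˡ (^-congʳ q (triGap-zero i))))) ⟩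
    - Σ< (suc a) f + Σ< (suc a) f             ≈⟨ -‿inverseˡ _ ⟩
    0#                                        ∎
    where
    f : ℕ → Carrier
    f i = sgn R i * q ^ tri R i * [ a , i ]

  alternatingSum-suc : ∀ a s → alternatingSum (suc a) (suc s) ≈ (q ^ suc s - 1#) * alternatingSum a s
  alternatingSum-suc a s = begin
    alternatingSum (suc a) (suc s) ≈⟨ alternatingSum-pascal a (suc s) ⟩
    - alternatingSum a s + Σ< (suc a) (λ i → sgn R i * q ^ (triGap i (suc s) ℕ.+ i) * [ a , i ])
      ≈⟨ +-congˡ (trans (sum-cong (suc a) shift) (sym (sum-*ˡ (suc a) _ _))) ⟩
    - alternatingSum a s + q ^ suc s * alternatingSum a s ≈⟨ solve 2 (λ g x → :- g :+ x :* g := (x :- con (1 , 0)) :* g) refl _ _ ⟩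
    (q ^ suc s - 1#) * alternatingSum a s ∎
    where
    shift : ∀ i → sgn R i * q ^ (triGap i (suc s) ℕ.+ i) * [ a , i ] ≈ q ^ suc s * (sgn R i * q ^ triGap i s * [ a , i ])
    shift i = trans (*-congʳ (*-congˡ (trans (^-congʳ q (triGap-suc i s)) (^-homo-* q (triGap i s) (suc s)))))
                    (solve 4 (λ s x y g → s :* (x :* y) :* g := y :* (s :* x :* g)) refl _ _ _ _)

  alternatingSum≈0 : ∀ a s → s ≤ a → alternatingSum (suc a) s ≈ 0#
  alternatingSum≈0 a       zero    _         = alternatingSum-zero a
  alternatingSum≈0 (suc a) (suc s) (s≤s s≤a) = trans (alternatingSum-suc (suc a) s) (trans (*-congˡ (alternatingSum≈0 a s s≤a)) (zeroʳ _))

  α : ℕ → Carrier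
  α zero    = 1#
  α (suc s) = sgn R (suc s) * q ^ tri R s * (1# + q ^ suc s)

  δ₀ : ℕ → Carrier
  δ₀ zero    = 1#
  δ₀ (suc _) = 0#

  αSum : ℕ → Carrier
  αSum n = Σ< (suc n) (λ r → [ n ℕ.+ n , n ℕ.+ r ] * α r)

  alternatingSum-middle : ∀ n → alternatingSum (n ℕ.+ n) n ≈ sgn R n * αSum n
  alternatingSum-middle n = begin
    Σ< (suc (n ℕ.+ n)) t                                       ≈⟨ reflexive (≡.cong (λ m → Σ< m t) (≡.sym (ℕ.+-suc n n))) ⟩
    Σ< (n ℕ.+ suc n) t                                         ≈⟨ sum-split n (suc n) t ⟩
    Σ< n t + Σ< (suc n) (λ r → t (n ℕ.+ r))                     ≈⟨ +-cong (trans (sum-reverse n t) (sum-cong-< n lower)) (sum-cong (suc n) upper) ⟩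
    Σ< n (λ j → sgn R n * L j) + Σ< (suc n) (λ r → sgn R n * U r) ≈⟨ +-cong (sym (sum-*ˡ n _ L)) (sym (sum-*ˡ (suc n) _ U)) ⟩
    sgn R n * Σ< n L + sgn R n * Σ< (suc n) U                  ≈⟨ sym (distribˡ _ _ _) ⟩
    sgn R n * (Σ< n L + Σ< (suc n) U)                          ≈⟨ *-congˡ combine ⟩
    sgn R n * αSum n                                           ∎
    where
    t L U : ℕ → Carrier
    t i = sgn R i * q ^ triGap i n * [ n ℕ.+ n , i ]
    L j = sgn R (suc j) * q ^ tri R (suc j) * [ n ℕ.+ n , n ℕ.+ suc j ]
    U r = sgn R r * q ^ triGap r 0 * [ n ℕ.+ n , n ℕ.+ r ]

    upper : ∀ r → t (n ℕ.+ r) ≈ sgn R n * U r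
    upper r = trans (*-congʳ (*-cong (sgn-+ n r) (^-congʳ q (triGap-above n r))))
                    (solve 4 (λ a b c d → a :* b :* c :* d := a :* (b :* c :* d)) refl _ _ _ _)

    lower : ∀ j → j < n → t (n ∸ suc j) ≈ sgn R n * L j
    lower j j<n = begin
      sgn R a * q ^ triGap a n * [ n ℕ.+ n , a ]
        ≈⟨ *-cong (*-cong sgn-a (^-congʳ q (≡.trans (≡.cong (triGap a) (≡.sym a+j+1≡n)) (triGap-below a (suc j))))) symmetric ⟩
      (sgn R n * sgn R (suc j)) * q ^ tri R (suc j) * [ n ℕ.+ n , n ℕ.+ suc j ]
        ≈⟨ solve 4 (λ a b c d → (a :* b) :* c :* d := a :* (b :* c :* d)) refl _ _ _ _ ⟩
      sgn R n * L j ∎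
      where
      a = n ∸ suc j
      a+j+1≡n : a ℕ.+ suc j ≡ n
      a+j+1≡n = ℕ.m∸n+n≡m j<n
      sgn-a : sgn R a ≈ sgn R n * sgn R (suc j)
      sgn-a = begin
        sgn R a                                 ≈⟨ sym (trans (*-congˡ (sgn*sgn (suc j))) (*-identityʳ _)) ⟩
        sgn R a * (sgn R (suc j) * sgn R (suc j)) ≈⟨ sym (*-assoc _ _ _) ⟩
        (sgn R a * sgn R (suc j)) * sgn R (suc j) ≈⟨ *-congʳ (sym (sgn-+ a (suc j))) ⟩
        sgn R (a ℕ.+ suc j) * sgn R (suc j)      ≈⟨ *-congʳ (reflexive (≡.cong (sgn R) a+j+1≡n)) ⟩
        sgn R n * sgn R (suc j)                 ∎
      n+n≡ : a ℕ.+ (n ℕ.+ suc j) ≡ n ℕ.+ n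
      n+n≡ = ≡.trans (≡.trans (≡.cong (a ℕ.+_) (ℕ.+-comm n (suc j))) (≡.sym (ℕ.+-assoc a (suc j) n))) (≡.cong (ℕ._+ n) a+j+1≡n)
      symmetric : [ n ℕ.+ n , a ] ≈ [ n ℕ.+ n , n ℕ.+ suc j ]
      symmetric = ≡.subst (λ m → [ m , a ] ≈ [ m , n ℕ.+ suc j ]) n+n≡ (gauss-symmetric a (n ℕ.+ suc j))

    combine : Σ< n L + Σ< (suc n) U ≈ αSum n
    combine = begin
      Σ< n L + Σ< (suc n) U                          ≈⟨ +-congˡ (sum-head n U) ⟩
      Σ< n L + (U 0 + Σ< n (λ j → U (suc j)))        ≈⟨ solve 3 (λ a b c → a :+ (b :+ c) := b :+ (a :+ c)) refl _ _ _ ⟩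
      U 0 + (Σ< n L + Σ< n (λ j → U (suc j)))        ≈⟨ +-cong U₀ (trans (sym (sum-+ n _ _)) (sum-cong n pair)) ⟩
      [ n ℕ.+ n , n ℕ.+ 0 ] * α 0 + Σ< n (λ j → [ n ℕ.+ n , n ℕ.+ suc j ] * α (suc j)) ≈⟨ sym (sum-head n _) ⟩
      αSum n                                         ∎
      where
      U₀ : U 0 ≈ [ n ℕ.+ n , n ℕ.+ 0 ] * α 0
      U₀ = trans (*-congʳ (*-identityʳ _)) (trans (*-identityˡ _) (sym (*-identityʳ _)))
      pair : ∀ j → L j + U (suc j) ≈ [ n ℕ.+ n , n ℕ.+ suc j ] * α (suc j)
      pair j = trans (+-congʳ (*-congʳ (*-congˡ (^-homo-* q (suc j) (tri R j)))))
        (solve 4 (λ s u x g → s :* (u :* x) :* g :+ s :* x :* g := g :* (s :* x :* (con (1 , 0) :+ u))) refl _ _ _ _)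

  unitPair : ∀ n → poch (suc n) n * δ₀ n ≈ αSum n
  unitPair zero    = solve 0 (con (1 , 0) :* con (1 , 0) := con (0 , 0) :+ con (1 , 0) :* con (1 , 0)) refl
  unitPair (suc n) = trans (zeroʳ _) (sym (begin
    αSum m                              ≈⟨ sym (trans (*-congʳ (sgn*sgn m)) (*-identityˡ _)) ⟩
    (sgn R m * sgn R m) * αSum m        ≈⟨ *-assoc _ _ _ ⟩
    sgn R m * (sgn R m * αSum m)        ≈⟨ *-congˡ (sym (alternatingSum-middle m)) ⟩
    sgn R m * alternatingSum (m ℕ.+ m) m ≈⟨ *-congˡ (alternatingSum≈0 (n ℕ.+ m) m (ℕ.m≤n+m m n)) ⟩
    sgn R m * 0#                        ≈⟨ zeroʳ _ ⟩
    0#                                  ∎))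
    where m = suc n

module PrimitiveRootOfUnity {ℓ₁ ℓ₂} (R : CommutativeRing ℓ₁ ℓ₂) (isField : IsFieldCR R)
                            (N′ : ℕ) (q : CommutativeRing.Carrier R) (q-primitive : PrimitiveRoot R (suc N′) q) where
  open CommutativeRing R hiding (zero)
  open import Algebra.Definitions.RawSemiring (Semiring.rawSemiring semiring) using (_^_)
  open import Algebra.Properties.Semiring.Exp semiring using (^-homo-*; ^-congʳ; ^-congˡ; ^-assocʳ)
  open import Algebra.Properties.Ring ring using (-‿distribˡ-*; x∙y⁻¹≈ε⇒x≈y)
  open IntegerCoefficientSolver R
  open FiniteSums R
  open GaussianBinomials R q
  open TriangularNumbers R
  open import Relation.Binary.Reasoning.Setoid setoid

  N : ℕ
  N = suc N′

  q^N≈1 : q ^ N ≈ 1#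
  q^N≈1 = proj₁ q-primitive

  q^N*≈1 : ∀ c → q ^ (N ℕ.* c) ≈ 1#
  q^N*≈1 c = trans (sym (^-assocʳ q N c)) (trans (^-congˡ c q^N≈1) (1^n≈1 c))

  ^-mod-N : ∀ a b c d → a ℕ.+ N ℕ.* c ≡ b ℕ.+ N ℕ.* d → q ^ a ≈ q ^ b
  ^-mod-N a b c d e = begin
    q ^ a                    ≈⟨ sym (trans (*-congˡ (q^N*≈1 c)) (*-identityʳ _)) ⟩
    q ^ a * q ^ (N ℕ.* c)    ≈⟨ sym (^-homo-* q a _) ⟩
    q ^ (a ℕ.+ N ℕ.* c)      ≈⟨ ^-congʳ q e ⟩
    q ^ (b ℕ.+ N ℕ.* d)      ≈⟨ ^-homo-* q b _ ⟩
    q ^ b * q ^ (N ℕ.* d)    ≈⟨ trans (*-congˡ (q^N*≈1 d)) (*-identityʳ _) ⟩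
    q ^ b                    ∎

  q⁻¹ : Carrier
  q⁻¹ = qinv R N q

  q⁻¹^ : ∀ x → q⁻¹ ^ x ≈ q ^ (N′ ℕ.* x)
  q⁻¹^ x = ^-assocʳ q N′ x

  Invertible : Carrier → Set _
  Invertible x = ∃ λ y → x * y ≈ 1#

  invertible-* : ∀ {x y} → Invertible x → Invertible y → Invertible (x * y)
  invertible-* (x′ , xx′≈1) (y′ , yy′≈1) =
    x′ * y′ , trans (solve 4 (λ x y a b → (x :* y) :* (a :* b) := (x :* a) :* (y :* b)) refl _ _ _ _)
                    (trans (*-cong xx′≈1 yy′≈1) (*-identityˡ 1#))

  *-cancelʳ : ∀ {u x y} → Invertible u → x * u ≈ y * u → x ≈ y
  *-cancelʳ {u} {x} {y} (u′ , uu′≈1) xu≈yu = begin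
    x             ≈⟨ sym (trans (*-congˡ uu′≈1) (*-identityʳ x)) ⟩
    x * (u * u′)  ≈⟨ sym (*-assoc x u u′) ⟩
    (x * u) * u′  ≈⟨ *-congʳ xu≈yu ⟩
    (y * u) * u′  ≈⟨ *-assoc y u u′ ⟩
    y * (u * u′)  ≈⟨ trans (*-congˡ uu′≈1) (*-identityʳ y) ⟩
    y             ∎

  1-q^i-invertible : ∀ i → 0 < i → i < N → Invertible (1# - q ^ i)
  1-q^i-invertible i 0<i i<N = isField _ (λ 1-q^i≈0 → proj₂ q-primitive i 0<i i<N (sym (x∙y⁻¹≈ε⇒x≈y 1# (q ^ i) 1-q^i≈0)))

  poch-invertible : ∀ k → k < N → Invertible (poch 1 k)
  poch-invertible zero    _      = 1# , *-identityˡ 1#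
  poch-invertible (suc k) k+1<N =
    invertible-* (poch-invertible k (ℕ.<-trans (ℕ.n<1+n k) k+1<N)) (1-q^i-invertible (suc k) (s≤s z≤n) k+1<N)

  x²≈1⇒x≈-1 : ∀ x → x * x ≈ 1# → ¬ (x ≈ 1#) → x ≈ - 1#
  x²≈1⇒x≈-1 x x²≈1 x≉1 = begin
    x               ≈⟨ solve 1 (λ x → x := (x :+ con (1 , 0)) :- con (1 , 0)) refl x ⟩
    (x + 1#) - 1#   ≈⟨ +-congʳ (*-cancelʳ x-1-invertible (trans (*-comm _ _) x²-1≈0)) ⟩
    0# - 1#         ≈⟨ +-identityˡ _ ⟩
    - 1#            ∎
    where
    x-1-invertible : Invertible (x - 1#)
    x-1-invertible = isField _ (λ x-1≈0 → x≉1 (x∙y⁻¹≈ε⇒x≈y x 1# x-1≈0))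
    x²-1≈0 : (x - 1#) * (x + 1#) ≈ 0# * (x - 1#)
    x²-1≈0 = begin
      (x - 1#) * (x + 1#) ≈⟨ solve 1 (λ x → (x :- con (1 , 0)) :* (x :+ con (1 , 0)) := x :* x :- con (1 , 0)) refl x ⟩
      x * x - 1#          ≈⟨ +-congʳ x²≈1 ⟩
      1# - 1#             ≈⟨ -‿inverseʳ 1# ⟩
      0#                  ≈⟨ sym (zeroˡ _) ⟩
      0# * (x - 1#)       ∎

  -1^≈sgn : ∀ m → (- 1#) ^ m ≈ sgn R m
  -1^≈sgn zero    = refl
  -1^≈sgn (suc m) = trans (*-congˡ (-1^≈sgn m)) (trans (sym (-‿distribˡ-* 1# (sgn R m))) (-‿cong (*-identityˡ _)))

  q^tri≈sgn : q ^ tri R N′ ≈ sgn R N′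
  q^tri≈sgn = by-parity (N′ ℕ.% 2) (N′ ℕ./ 2) (m%n<n N′ 2) (m≡m%n+[m/n]*n N′ 2)
    where
    halve : ∀ a b → a ℕ.+ a ≡ b ℕ.+ b → a ≡ b
    halve a b e = ℕ.*-cancelˡ-≡ a b 2 (≡.trans (twice a) (≡.trans e (≡.sym (twice b))))
      where
      twice : ∀ x → 2 ℕ.* x ≡ x ℕ.+ x
      twice x = ≡.cong (x ℕ.+_) (ℕ.+-identityʳ x)
    by-parity : ∀ s h → s < 2 → N′ ≡ s ℕ.+ h ℕ.* 2 → q ^ tri R N′ ≈ sgn R N′
    by-parity 0 h _ N′≡2h = begin
      q ^ tri R N′      ≈⟨ ^-congʳ q (halve (tri R N′) (N ℕ.* h) (≡.trans (tri-double N′) (≡.trans (≡.cong (ℕ._* N) N′≡2h) (regroup h N)))) ⟩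
      q ^ (N ℕ.* h)     ≈⟨ q^N*≈1 h ⟩
      1#                ≈⟨ sym (trans (sgn-+ h h) (sgn*sgn h)) ⟩
      sgn R (h ℕ.+ h)   ≈⟨ reflexive (≡.cong (sgn R) (≡.sym (≡.trans N′≡2h (double h)))) ⟩
      sgn R N′          ∎
      where
      regroup : ∀ h n → (0 ℕ.+ h ℕ.* 2) ℕ.* n ≡ n ℕ.* h ℕ.+ n ℕ.* h
      regroup = solve-∀
      double : ∀ h → 0 ℕ.+ h ℕ.* 2 ≡ h ℕ.+ h
      double = solve-∀
    by-parity 1 h _ N′≡2h+1 = begin
      q ^ tri R N′           ≈⟨ ^-congʳ q (halve (tri R N′) M (≡.trans (tri-double N′) (≡.trans (≡.cong (λ n → n ℕ.* suc n) N′≡2h+1) (regroup h)))) ⟩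
      q ^ (suc h ℕ.* M′)     ≈⟨ sym (^-assocʳ q (suc h) M′) ⟩
      (q ^ suc h) ^ M′       ≈⟨ ^-congˡ M′ q^[h+1]≈-1 ⟩
      (- 1#) ^ M′            ≈⟨ -1^≈sgn M′ ⟩
      sgn R M′               ≈⟨ reflexive (≡.cong (sgn R) (≡.sym N′≡2h+1)) ⟩
      sgn R N′               ∎
      where
      M′ = 1 ℕ.+ h ℕ.* 2
      M = suc h ℕ.* M′
      regroup : ∀ h → (1 ℕ.+ h ℕ.* 2) ℕ.* suc (1 ℕ.+ h ℕ.* 2) ≡ (1 ℕ.+ h) ℕ.* (1 ℕ.+ h ℕ.* 2) ℕ.+ (1 ℕ.+ h) ℕ.* (1 ℕ.+ h ℕ.* 2)
      regroup = solve-∀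
      N≡2[h+1] : ∀ h → suc h ℕ.+ suc h ≡ suc (1 ℕ.+ h ℕ.* 2)
      N≡2[h+1] = solve-∀
      h+1<N : suc h < N
      h+1<N = ≡.subst (λ n → suc h < suc n) (≡.sym N′≡2h+1) (s≤s (s≤s (ℕ.m≤m*n h 2)))
      q^[h+1]≈-1 : q ^ suc h ≈ - 1#
      q^[h+1]≈-1 = x²≈1⇒x≈-1 (q ^ suc h)
        (trans (sym (^-homo-* q (suc h) (suc h))) (trans (^-congʳ q (≡.trans (N≡2[h+1] h) (≡.cong suc (≡.sym N′≡2h+1)))) q^N≈1))
        (proj₂ q-primitive (suc h) (s≤s z≤n) h+1<N)
    by-parity (suc (suc _)) _ (s≤s (s≤s ())) _

module BaileyLemma {ℓ₁ ℓ₂} (R : CommutativeRing ℓ₁ ℓ₂) (isField : IsFieldCR R)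
                   (N′ : ℕ) (q : CommutativeRing.Carrier R) (q-primitive : PrimitiveRoot R (suc N′) q) where
  open CommutativeRing R hiding (zero)
  open import Algebra.Definitions.RawSemiring (Semiring.rawSemiring semiring) using (_^_)
  open import Algebra.Properties.Semiring.Exp semiring using (^-homo-*; ^-congʳ)
  open IntegerCoefficientSolver R
  open FiniteSums R
  open GaussianBinomials R q
  open ChuVandermonde R q
  open UnitBaileyPair R q
  open PrimitiveRootOfUnity R isField N′ q q-primitive
  open import Relation.Binary.Reasoning.Setoid setoid

  private
    <N-left : ∀ a b → a ℕ.+ b < N → a < N
    <N-left a b = ℕ.≤-<-trans (ℕ.m≤m+n a b)

    <N-right : ∀ a b → a ℕ.+ b < N → b < N
    <N-right a b = ℕ.≤-<-trans (ℕ.m≤n+m b a)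

    gauss-≡ˡ : ∀ {n n′} k → n ≡ n′ → [ n , k ] ≈ [ n′ , k ]
    gauss-≡ˡ k n≡n′ = reflexive (≡.cong [_, k ] n≡n′)

    poch-≡ : ∀ {a a′ k k′} → a ≡ a′ → k ≡ k′ → poch a k ≈ poch a′ k′
    poch-≡ a≡a′ k≡k′ = reflexive (≡.cong₂ poch a≡a′ k≡k′)

    poch-≡ˡ : ∀ {a a′} k → a ≡ a′ → poch a k ≈ poch a′ k
    poch-≡ˡ k a≡a′ = reflexive (≡.cong (λ a → poch a k) a≡a′)

  -- With m = n + l, both sides times (q)_n (q)_l equal (q)_{2m}.
  poch*gauss-factor : ∀ n l → n ℕ.+ l < N →
    poch (suc (n ℕ.+ l)) (n ℕ.+ l) * [ n ℕ.+ l , n ] ≈ poch (suc n) n * [ (n ℕ.+ l) ℕ.+ (n ℕ.+ l) , n ℕ.+ n ] * poch (suc l) l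
  poch*gauss-factor n l n+l<N =
    *-cancelʳ (invertible-* (poch-invertible n (<N-left n l n+l<N)) (poch-invertible l (<N-right n l n+l<N))) (trans lhs (sym rhs))
    where
    m = n ℕ.+ l
    2m≡ : m ℕ.+ m ≡ (n ℕ.+ n) ℕ.+ (l ℕ.+ l)
    2m≡ = regroup n l
      where
      regroup : ∀ n l → (n ℕ.+ l) ℕ.+ (n ℕ.+ l) ≡ (n ℕ.+ n) ℕ.+ (l ℕ.+ l)
      regroup = solve-∀
    lhs : poch (suc m) m * [ m , n ] * (poch 1 n * poch 1 l) ≈ poch 1 (m ℕ.+ m)
    lhs = begin
      poch (suc m) m * [ m , n ] * (poch 1 n * poch 1 l) ≈⟨ solve 4 (λ a g x y → a :* g :* (x :* y) := a :* (g :* x :* y)) refl _ _ _ _ ⟩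
      poch (suc m) m * ([ m , n ] * poch 1 n * poch 1 l) ≈⟨ *-congˡ (gauss-factorial n l) ⟩
      poch (suc m) m * poch 1 m                          ≈⟨ *-comm _ _ ⟩
      poch 1 m * poch (1 ℕ.+ m) m                        ≈⟨ sym (poch-split 1 m m) ⟩
      poch 1 (m ℕ.+ m)                                   ∎
    rhs : poch (suc n) n * [ m ℕ.+ m , n ℕ.+ n ] * poch (suc l) l * (poch 1 n * poch 1 l) ≈ poch 1 (m ℕ.+ m)
    rhs = begin
      poch (suc n) n * [ m ℕ.+ m , n ℕ.+ n ] * poch (suc l) l * (poch 1 n * poch 1 l)
        ≈⟨ solve 5 (λ a g b x y → a :* g :* b :* (x :* y) := g :* (x :* a) :* (y :* b)) refl _ _ _ _ _ ⟩
      [ m ℕ.+ m , n ℕ.+ n ] * (poch 1 n * poch (1 ℕ.+ n) n) * (poch 1 l * poch (1 ℕ.+ l) l)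
        ≈⟨ *-cong (*-cong (gauss-≡ˡ (n ℕ.+ n) 2m≡) (sym (poch-split 1 n n))) (sym (poch-split 1 l l)) ⟩
      [ (n ℕ.+ n) ℕ.+ (l ℕ.+ l) , n ℕ.+ n ] * poch 1 (n ℕ.+ n) * poch 1 (l ℕ.+ l) ≈⟨ gauss-factorial (n ℕ.+ n) (l ℕ.+ l) ⟩
      poch 1 ((n ℕ.+ n) ℕ.+ (l ℕ.+ l))                                             ≈⟨ reflexive (≡.cong (poch 1) (≡.sym 2m≡)) ⟩
      poch 1 (m ℕ.+ m)                                                              ∎

  -- With n = r + k and m = r + (k + l): both sides times (q)_l (q)_k equal (q^{n+r+1})_{k+2l}.
  gauss-double-exchange : ∀ r k l → r ℕ.+ (k ℕ.+ l) < N →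
    [ (r ℕ.+ (k ℕ.+ l)) ℕ.+ (r ℕ.+ (k ℕ.+ l)) , (r ℕ.+ k) ℕ.+ (r ℕ.+ k) ] * poch (suc l) l * [ (r ℕ.+ k) ℕ.+ (r ℕ.+ k) , (r ℕ.+ k) ℕ.+ r ]
      ≈ [ (r ℕ.+ (k ℕ.+ l)) ℕ.+ (r ℕ.+ (k ℕ.+ l)) , (r ℕ.+ (k ℕ.+ l)) ℕ.+ r ] * [ k ℕ.+ l , k ] * poch (k ℕ.+ (r ℕ.+ r) ℕ.+ 1) l
  gauss-double-exchange r k l m<N =
    *-cancelʳ (invertible-* (poch-invertible l l<N) (poch-invertible k k<N)) (trans lhs (sym rhs))
    where
    n = r ℕ.+ k
    m = r ℕ.+ (k ℕ.+ l)
    k+l<N = <N-right r (k ℕ.+ l) m<N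
    l<N = <N-right k l k+l<N
    k<N = <N-left k l k+l<N
    T = poch (suc (n ℕ.+ r)) (k ℕ.+ (l ℕ.+ l))
    e₁ : m ℕ.+ m ≡ (n ℕ.+ n) ℕ.+ (l ℕ.+ l)
    e₁ = regroup r k l
      where
      regroup : ∀ r k l → (r ℕ.+ (k ℕ.+ l)) ℕ.+ (r ℕ.+ (k ℕ.+ l)) ≡ ((r ℕ.+ k) ℕ.+ (r ℕ.+ k)) ℕ.+ (l ℕ.+ l)
      regroup = solve-∀
    e₂ : n ℕ.+ n ≡ (n ℕ.+ r) ℕ.+ k
    e₂ = regroup r k
      where
      regroup : ∀ r k → (r ℕ.+ k) ℕ.+ (r ℕ.+ k) ≡ ((r ℕ.+ k) ℕ.+ r) ℕ.+ k
      regroup = solve-∀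
    e₃ : suc (n ℕ.+ r) ℕ.+ k ≡ suc (n ℕ.+ n)
    e₃ = ≡.cong suc (≡.sym e₂)
    f₁ : m ℕ.+ m ≡ (m ℕ.+ r) ℕ.+ (k ℕ.+ l)
    f₁ = regroup r k l
      where
      regroup : ∀ r k l → (r ℕ.+ (k ℕ.+ l)) ℕ.+ (r ℕ.+ (k ℕ.+ l)) ≡ ((r ℕ.+ (k ℕ.+ l)) ℕ.+ r) ℕ.+ (k ℕ.+ l)
      regroup = solve-∀
    f₂ : k ℕ.+ (r ℕ.+ r) ℕ.+ 1 ℕ.+ l ≡ suc (m ℕ.+ r)
    f₂ = regroup r k l
      where
      regroup : ∀ r k l → k ℕ.+ (r ℕ.+ r) ℕ.+ 1 ℕ.+ l ≡ suc ((r ℕ.+ (k ℕ.+ l)) ℕ.+ r)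
      regroup = solve-∀
    f₃ : k ℕ.+ (r ℕ.+ r) ℕ.+ 1 ≡ suc (n ℕ.+ r)
    f₃ = regroup r k
      where
      regroup : ∀ r k → k ℕ.+ (r ℕ.+ r) ℕ.+ 1 ≡ suc ((r ℕ.+ k) ℕ.+ r)
      regroup = solve-∀
    f₄ : l ℕ.+ (k ℕ.+ l) ≡ k ℕ.+ (l ℕ.+ l)
    f₄ = regroup k l
      where
      regroup : ∀ k l → l ℕ.+ (k ℕ.+ l) ≡ k ℕ.+ (l ℕ.+ l)
      regroup = solve-∀
    lhs : [ m ℕ.+ m , n ℕ.+ n ] * poch (suc l) l * [ n ℕ.+ n , n ℕ.+ r ] * (poch 1 l * poch 1 k) ≈ T
    lhs = begin
      [ m ℕ.+ m , n ℕ.+ n ] * poch (suc l) l * [ n ℕ.+ n , n ℕ.+ r ] * (poch 1 l * poch 1 k)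
        ≈⟨ solve 5 (λ g a h x y → g :* a :* h :* (x :* y) := (g :* (x :* a)) :* (h :* y)) refl _ _ _ _ _ ⟩
      ([ m ℕ.+ m , n ℕ.+ n ] * (poch 1 l * poch (1 ℕ.+ l) l)) * ([ n ℕ.+ n , n ℕ.+ r ] * poch 1 k)
        ≈⟨ *-cong (*-cong (gauss-≡ˡ (n ℕ.+ n) e₁) (sym (poch-split 1 l l))) (*-congʳ (gauss-≡ˡ (n ℕ.+ r) e₂)) ⟩
      ([ (n ℕ.+ n) ℕ.+ (l ℕ.+ l) , n ℕ.+ n ] * poch 1 (l ℕ.+ l)) * ([ (n ℕ.+ r) ℕ.+ k , n ℕ.+ r ] * poch 1 k)
        ≈⟨ *-cong (gauss*poch-coindex (n ℕ.+ n) (l ℕ.+ l)) (gauss*poch-coindex (n ℕ.+ r) k) ⟩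
      poch (suc (n ℕ.+ n)) (l ℕ.+ l) * poch (suc (n ℕ.+ r)) k   ≈⟨ *-comm _ _ ⟩
      poch (suc (n ℕ.+ r)) k * poch (suc (n ℕ.+ n)) (l ℕ.+ l)   ≈⟨ *-congˡ (poch-≡ˡ (l ℕ.+ l) (≡.sym e₃)) ⟩
      poch (suc (n ℕ.+ r)) k * poch (suc (n ℕ.+ r) ℕ.+ k) (l ℕ.+ l) ≈⟨ sym (poch-split (suc (n ℕ.+ r)) k (l ℕ.+ l)) ⟩
      T                                                         ∎
    rhs : [ m ℕ.+ m , m ℕ.+ r ] * [ k ℕ.+ l , k ] * poch (k ℕ.+ (r ℕ.+ r) ℕ.+ 1) l * (poch 1 l * poch 1 k) ≈ T
    rhs = begin
      [ m ℕ.+ m , m ℕ.+ r ] * [ k ℕ.+ l , k ] * poch (k ℕ.+ (r ℕ.+ r) ℕ.+ 1) l * (poch 1 l * poch 1 k)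
        ≈⟨ solve 5 (λ g h a x y → g :* h :* a :* (x :* y) := (g :* (h :* y :* x)) :* a) refl _ _ _ _ _ ⟩
      ([ m ℕ.+ m , m ℕ.+ r ] * ([ k ℕ.+ l , k ] * poch 1 k * poch 1 l)) * poch (k ℕ.+ (r ℕ.+ r) ℕ.+ 1) l
        ≈⟨ *-congʳ (*-cong (gauss-≡ˡ (m ℕ.+ r) f₁) (gauss-factorial k l)) ⟩
      ([ (m ℕ.+ r) ℕ.+ (k ℕ.+ l) , m ℕ.+ r ] * poch 1 (k ℕ.+ l)) * poch (k ℕ.+ (r ℕ.+ r) ℕ.+ 1) l
        ≈⟨ *-congʳ (gauss*poch-coindex (m ℕ.+ r) (k ℕ.+ l)) ⟩
      poch (suc (m ℕ.+ r)) (k ℕ.+ l) * poch (k ℕ.+ (r ℕ.+ r) ℕ.+ 1) l   ≈⟨ *-comm _ _ ⟩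
      poch (k ℕ.+ (r ℕ.+ r) ℕ.+ 1) l * poch (suc (m ℕ.+ r)) (k ℕ.+ l)   ≈⟨ *-congˡ (poch-≡ˡ (k ℕ.+ l) (≡.sym f₂)) ⟩
      poch (k ℕ.+ (r ℕ.+ r) ℕ.+ 1) l * poch (k ℕ.+ (r ℕ.+ r) ℕ.+ 1 ℕ.+ l) (k ℕ.+ l)
        ≈⟨ sym (poch-split (k ℕ.+ (r ℕ.+ r) ℕ.+ 1) l (k ℕ.+ l)) ⟩
      poch (k ℕ.+ (r ℕ.+ r) ℕ.+ 1) (l ℕ.+ (k ℕ.+ l))                    ≈⟨ poch-≡ f₃ f₄ ⟩
      T                                                                 ∎

  kernel : ℕ → ℕ → ℕ → Carrier
  kernel r m n = q ^ (n ℕ.* n) * [ m ℕ.+ m , n ℕ.+ n ] * poch (suc (m ∸ n)) (m ∸ n) * [ n ℕ.+ n , n ℕ.+ r ]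

  kernel≈chuTerm : ∀ r M k → k ≤ M → r ℕ.+ M < N →
    kernel r (r ℕ.+ M) (r ℕ.+ k) ≈ [ (r ℕ.+ M) ℕ.+ (r ℕ.+ M) , (r ℕ.+ M) ℕ.+ r ] * (q ^ (r ℕ.* r) * chuTerm M (r ℕ.+ r) k)
  kernel≈chuTerm r M k k≤M m<N with ℕ.m≤n⇒∃[o]m+o≡n k≤M
  ... | l , ≡.refl = begin
    q ^ (n ℕ.* n) * [ m ℕ.+ m , n ℕ.+ n ] * poch (suc (m ∸ n)) (m ∸ n) * [ n ℕ.+ n , n ℕ.+ r ]
      ≈⟨ solve 4 (λ a b c d → a :* b :* c :* d := a :* (b :* c :* d)) refl _ _ _ _ ⟩
    q ^ (n ℕ.* n) * ([ m ℕ.+ m , n ℕ.+ n ] * poch (suc (m ∸ n)) (m ∸ n) * [ n ℕ.+ n , n ℕ.+ r ])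
      ≈⟨ *-congˡ (*-congʳ (*-congˡ (poch-≡ (≡.cong suc m∸n≡l) m∸n≡l))) ⟩
    q ^ (n ℕ.* n) * ([ m ℕ.+ m , n ℕ.+ n ] * poch (suc l) l * [ n ℕ.+ n , n ℕ.+ r ])
      ≈⟨ *-cong (trans (^-congʳ q (square r k)) (^-homo-* q (r ℕ.* r) _)) (gauss-double-exchange r k l m<N) ⟩
    (q ^ (r ℕ.* r) * q ^ ((r ℕ.+ r) ℕ.* k ℕ.+ k ℕ.* k)) * ([ m ℕ.+ m , m ℕ.+ r ] * [ k ℕ.+ l , k ] * poch (k ℕ.+ (r ℕ.+ r) ℕ.+ 1) l)
      ≈⟨ *-congˡ (*-congˡ (reflexive (≡.cong (poch (k ℕ.+ (r ℕ.+ r) ℕ.+ 1)) (≡.sym (ℕ.m+n∸m≡n k l))))) ⟩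
    (q ^ (r ℕ.* r) * q ^ ((r ℕ.+ r) ℕ.* k ℕ.+ k ℕ.* k)) * ([ m ℕ.+ m , m ℕ.+ r ] * [ k ℕ.+ l , k ] * poch (k ℕ.+ (r ℕ.+ r) ℕ.+ 1) ((k ℕ.+ l) ∸ k))
      ≈⟨ solve 5 (λ a b g h c → (a :* b) :* (g :* h :* c) := g :* (a :* (b :* h :* c))) refl _ _ _ _ _ ⟩
    [ m ℕ.+ m , m ℕ.+ r ] * (q ^ (r ℕ.* r) * chuTerm (k ℕ.+ l) (r ℕ.+ r) k) ∎
    where
    n = r ℕ.+ k
    m = r ℕ.+ (k ℕ.+ l)
    m∸n≡l : m ∸ n ≡ l
    m∸n≡l = ≡.trans (ℕ.[m+n]∸[m+o]≡n∸o r (k ℕ.+ l) k) (ℕ.m+n∸m≡n k l)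
    square : ∀ r k → (r ℕ.+ k) ℕ.* (r ℕ.+ k) ≡ r ℕ.* r ℕ.+ ((r ℕ.+ r) ℕ.* k ℕ.+ k ℕ.* k)
    square = solve-∀

  kernel-sum : ∀ r m → r ≤ m → m < N → Σ< (suc m) (kernel r m) ≈ q ^ (r ℕ.* r) * [ m ℕ.+ m , m ℕ.+ r ]
  kernel-sum r m r≤m m<N with ℕ.m≤n⇒∃[o]m+o≡n r≤m
  ... | M , ≡.refl = begin
    Σ< (suc (r ℕ.+ M)) (kernel r m)                                  ≈⟨ reflexive (≡.cong (λ z → Σ< z (kernel r m)) (≡.sym (ℕ.+-suc r M))) ⟩
    Σ< (r ℕ.+ suc M) (kernel r m)                                    ≈⟨ sum-split r (suc M) _ ⟩
    Σ< r (kernel r m) + Σ< (suc M) (λ k → kernel r m (r ℕ.+ k))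
      ≈⟨ +-cong (sum-zero r below-r) (sum-cong-< (suc M) (λ k k<M+1 → kernel≈chuTerm r M k (ℕ.≤-pred k<M+1) m<N)) ⟩
    0# + Σ< (suc M) (λ k → G * (q ^ (r ℕ.* r) * chuTerm M (r ℕ.+ r) k)) ≈⟨ +-identityˡ _ ⟩
    Σ< (suc M) (λ k → G * (q ^ (r ℕ.* r) * chuTerm M (r ℕ.+ r) k))      ≈⟨ sym (sum-*ˡ (suc M) G _) ⟩
    G * Σ< (suc M) (λ k → q ^ (r ℕ.* r) * chuTerm M (r ℕ.+ r) k)        ≈⟨ *-congˡ (sym (sum-*ˡ (suc M) _ _)) ⟩
    G * (q ^ (r ℕ.* r) * chuSum M (r ℕ.+ r))                         ≈⟨ *-congˡ (trans (*-congˡ (chuSum≈1 M (r ℕ.+ r))) (*-identityʳ _)) ⟩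
    G * q ^ (r ℕ.* r)                                                ≈⟨ *-comm _ _ ⟩
    q ^ (r ℕ.* r) * G                                                ∎
    where
    G = [ m ℕ.+ m , m ℕ.+ r ]
    below-r : ∀ i → i < r → kernel r m i ≈ 0#
    below-r i i<r = trans (*-congˡ (gauss≈0 (ℕ.+-monoʳ-< i i<r))) (zeroʳ _)

  -- (w, A) is a Bailey pair relative to 1, with w n standing for (q)_n β_n; only n < N is
  -- asked for, since that is where (q)_n is invertible.
  IsBaileyPair : (ℕ → Carrier) → (ℕ → Carrier) → Set _
  IsBaileyPair w A = ∀ n → n < N → poch (suc n) n * w n ≈ Σ< (suc n) (λ r → [ n ℕ.+ n , n ℕ.+ r ] * A r)

  IsBaileyPair-congˡ : ∀ {w w′ A} → (∀ n → w n ≈ w′ n) → IsBaileyPair w A → IsBaileyPair w′ A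
  IsBaileyPair-congˡ w≈w′ pair n n<N = trans (*-congˡ (sym (w≈w′ n))) (pair n n<N)

  IsBaileyPair-congʳ : ∀ {w A A′} → (∀ r → A r ≈ A′ r) → IsBaileyPair w A → IsBaileyPair w A′
  IsBaileyPair-congʳ A≈A′ pair n n<N = trans (pair n n<N) (sum-cong (suc n) (λ r → *-congˡ (A≈A′ r)))

  unitBaileyPair : IsBaileyPair δ₀ α
  unitBaileyPair n _ = unitPair n

  baileyTransform : (ℕ → Carrier) → ℕ → Carrier
  baileyTransform w m = Σ< (suc m) (λ n → q ^ (n ℕ.* n) * [ m , n ] * w n)

  private
    transform-term : ∀ {w A} → IsBaileyPair w A → ∀ m n → n ≤ m → m < N →
      poch (suc m) m * (q ^ (n ℕ.* n) * [ m , n ] * w n) ≈ Σ< (suc m) (λ r → kernel r m n * A r)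
    transform-term {w} {A} pair m n n≤m m<N with ℕ.m≤n⇒∃[o]m+o≡n n≤m
    ... | l , ≡.refl = begin
      poch (suc m) m * (q ^ (n ℕ.* n) * [ m , n ] * w n)           ≈⟨ solve 4 (λ a b c d → a :* (b :* c :* d) := b :* (a :* c) :* d) refl _ _ _ _ ⟩
      q ^ (n ℕ.* n) * (poch (suc m) m * [ m , n ]) * w n           ≈⟨ *-congʳ (*-congˡ (poch*gauss-factor n l m<N)) ⟩
      q ^ (n ℕ.* n) * (poch (suc n) n * [ m ℕ.+ m , n ℕ.+ n ] * poch (suc l) l) * w n
        ≈⟨ solve 5 (λ a b c d e → a :* (b :* c :* d) :* e := a :* c :* d :* (b :* e)) refl _ _ _ _ _ ⟩
      Y * (poch (suc n) n * w n)                                  ≈⟨ *-congˡ (pair n (<N-left n l m<N)) ⟩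
      Y * Σ< (suc n) (λ r → [ n ℕ.+ n , n ℕ.+ r ] * A r)          ≈⟨ sum-*ˡ (suc n) Y _ ⟩
      Σ< (suc n) (λ r → Y * ([ n ℕ.+ n , n ℕ.+ r ] * A r))        ≈⟨ sym (sum-extend _ (s≤s (ℕ.m≤m+n n l)) above-n) ⟩
      Σ< (suc m) (λ r → Y * ([ n ℕ.+ n , n ℕ.+ r ] * A r))
        ≈⟨ sum-cong (suc m) (λ r → trans (sym (*-assoc _ _ _)) (*-congʳ (*-congʳ (*-congˡ (poch-≡ (≡.cong suc (≡.sym m∸n≡l)) (≡.sym m∸n≡l)))))) ⟩
      Σ< (suc m) (λ r → kernel r m n * A r)                        ∎
      where
      Y = q ^ (n ℕ.* n) * [ m ℕ.+ m , n ℕ.+ n ] * poch (suc l) l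
      m∸n≡l : m ∸ n ≡ l
      m∸n≡l = ℕ.m+n∸m≡n n l
      above-n : ∀ r → suc n ≤ r → r < suc m → Y * ([ n ℕ.+ n , n ℕ.+ r ] * A r) ≈ 0#
      above-n r n<r _ = trans (*-congˡ (trans (*-congʳ (gauss≈0 (ℕ.+-monoʳ-< n n<r))) (zeroˡ _))) (zeroʳ _)

  bailey-lemma : ∀ {w A} → IsBaileyPair w A → IsBaileyPair (baileyTransform w) (λ r → q ^ (r ℕ.* r) * A r)
  bailey-lemma {w} {A} pair m m<N = begin
    poch (suc m) m * baileyTransform w m                             ≈⟨ sum-*ˡ (suc m) _ _ ⟩
    Σ< (suc m) (λ n → poch (suc m) m * (q ^ (n ℕ.* n) * [ m , n ] * w n))
      ≈⟨ sum-cong-< (suc m) (λ n n<m+1 → transform-term pair m n (ℕ.≤-pred n<m+1) m<N) ⟩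
    Σ< (suc m) (λ n → Σ< (suc m) (λ r → kernel r m n * A r))        ≈⟨ sum-swap (suc m) (suc m) _ ⟩
    Σ< (suc m) (λ r → Σ< (suc m) (λ n → kernel r m n * A r))
      ≈⟨ sum-cong-< (suc m) (λ r r<m+1 → trans (sym (sum-*ʳ (suc m) (A r) (kernel r m))) (*-congʳ (kernel-sum r m (ℕ.≤-pred r<m+1) m<N))) ⟩
    Σ< (suc m) (λ r → q ^ (r ℕ.* r) * [ m ℕ.+ m , m ℕ.+ r ] * A r)
      ≈⟨ sum-cong (suc m) (λ r → solve 3 (λ a b c → a :* b :* c := b :* (a :* c)) refl _ _ _) ⟩
    Σ< (suc m) (λ r → [ m ℕ.+ m , m ℕ.+ r ] * (q ^ (r ℕ.* r) * A r)) ∎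

  chainA : ℕ → ℕ → Carrier
  chainA j r = q ^ (suc j ℕ.* (r ℕ.* r)) * α r

  inner-isBaileyPair : ∀ j → IsBaileyPair (inner R q j) (chainA j)
  inner-isBaileyPair zero    = IsBaileyPair-congˡ transform-δ₀ (IsBaileyPair-congʳ exponent (bailey-lemma unitBaileyPair))
    where
    transform-δ₀ : ∀ m → baileyTransform δ₀ m ≈ 1#
    transform-δ₀ m = trans (sum-head m _) (trans (+-cong (trans (*-identityʳ _) (*-identityʳ _)) (sum-zero m (λ i _ → zeroʳ _))) (+-identityʳ 1#))
    exponent : ∀ r → q ^ (r ℕ.* r) * α r ≈ chainA 0 r
    exponent r = *-congʳ (^-congʳ q (≡.sym (ℕ.+-identityʳ (r ℕ.* r))))
  inner-isBaileyPair (suc j) = IsBaileyPair-congʳ exponent (bailey-lemma (inner-isBaileyPair j))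
    where
    exponent : ∀ r → q ^ (r ℕ.* r) * chainA j r ≈ chainA (suc j) r
    exponent r = trans (sym (*-assoc _ _ _)) (*-congʳ (sym (^-homo-* q (r ℕ.* r) _)))

module ColumnSums {ℓ₁ ℓ₂} (R : CommutativeRing ℓ₁ ℓ₂) (isField : IsFieldCR R)
                  (N′ : ℕ) (q : CommutativeRing.Carrier R) (q-primitive : PrimitiveRoot R (suc N′) q) where
  open CommutativeRing R hiding (zero)
  open import Algebra.Definitions.RawSemiring (Semiring.rawSemiring semiring) using (_^_)
  open import Algebra.Properties.Semiring.Exp semiring using (^-homo-*; ^-congʳ)
  open IntegerCoefficientSolver R
  open FiniteSums R
  open GaussianBinomials R q
  open TriangularNumbers R
  open DiagonalSums R q using (D)
  open PrimitiveRootOfUnity R isField N′ q q-primitive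
  open import Relation.Binary.Reasoning.Setoid setoid

  columnSum : ℕ → Carrier
  columnSum r = Σ< N (λ m → q⁻¹ ^ (m ℕ.* m ℕ.+ m) * [ m ℕ.+ m , m ℕ.+ r ])

  prod-neg-powers : ∀ i a → Π< i (λ l → - q ^ (a ℕ.+ l)) ≈ sgn R i * q ^ (i ℕ.* a ℕ.+ tri R (i ∸ 1))
  prod-neg-powers zero    a = sym (*-identityˡ 1#)
  prod-neg-powers (suc i) a = begin
    Π< i (λ l → - q ^ (a ℕ.+ l)) * - q ^ (a ℕ.+ i)                   ≈⟨ *-congʳ (prod-neg-powers i a) ⟩
    sgn R i * q ^ (i ℕ.* a ℕ.+ tri R (i ∸ 1)) * - q ^ (a ℕ.+ i)        ≈⟨ solve 3 (λ s x y → s :* x :* (:- y) := (:- s) :* (x :* y)) refl _ _ _ ⟩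
    - sgn R i * (q ^ (i ℕ.* a ℕ.+ tri R (i ∸ 1)) * q ^ (a ℕ.+ i))      ≈⟨ *-congˡ (trans (sym (^-homo-* q (i ℕ.* a ℕ.+ tri R (i ∸ 1)) (a ℕ.+ i))) (^-congʳ q exponent)) ⟩
    - sgn R i * q ^ (suc i ℕ.* a ℕ.+ tri R i)                         ∎
    where
    regroup : ∀ i a t → i ℕ.* a ℕ.+ t ℕ.+ (a ℕ.+ i) ≡ suc i ℕ.* a ℕ.+ (i ℕ.+ t)
    regroup = solve-∀
    exponent : i ℕ.* a ℕ.+ tri R (i ∸ 1) ℕ.+ (a ℕ.+ i) ≡ suc i ℕ.* a ℕ.+ tri R i
    exponent = ≡.trans (regroup i a (tri R (i ∸ 1))) (≡.cong (suc i ℕ.* a ℕ.+_) (≡.sym (tri-pred i)))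

  1-q^x≈-q^x*[1-q^y] : ∀ x y → q ^ (x ℕ.+ y) ≈ 1# → 1# - q ^ x ≈ (- q ^ x) * (1# - q ^ y)
  1-q^x≈-q^x*[1-q^y] x y q^[x+y]≈1 = begin
    1# - q ^ x             ≈⟨ +-congʳ (sym (trans (sym (^-homo-* q x y)) q^[x+y]≈1)) ⟩
    q ^ x * q ^ y - q ^ x  ≈⟨ solve 2 (λ a b → a :* b :- a := (:- a) :* (con (1 , 0) :- b)) refl _ _ ⟩
    (- q ^ x) * (1# - q ^ y) ∎

  -- The factors of (q^{m+r+1})_i pair up, modulo q^N = 1, with those of (q^{2j+2})_i read backwards.
  column-term : ∀ i j r → i ℕ.+ j ℕ.+ r ≡ N′ →
    q⁻¹ ^ ((i ℕ.+ r) ℕ.* (i ℕ.+ r) ℕ.+ (i ℕ.+ r)) * [ (i ℕ.+ r) ℕ.+ (i ℕ.+ r) , (i ℕ.+ r) ℕ.+ r ]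
      ≈ q⁻¹ ^ ((i ℕ.+ j) ℕ.* (i ℕ.+ j) ℕ.+ (i ℕ.+ j)) * (sgn R i * q ^ tri R (i ∸ 1) * [ i ℕ.+ (j ℕ.+ j ℕ.+ 1) , i ])
  column-term i j r i+j+r≡N′ = *-cancelʳ (poch-invertible i i<N) (trans lhs (sym rhs))
    where
    m = i ℕ.+ r
    k = i ℕ.+ j
    a₀ = suc (m ℕ.+ r)
    b₀ = suc (j ℕ.+ j ℕ.+ 1)
    i<N : i < N
    i<N = s≤s (≡.subst (i ≤_) i+j+r≡N′ (ℕ.≤-trans (ℕ.m≤m+n i j) (ℕ.m≤m+n (i ℕ.+ j) r)))
    Q⁻ᵐ = q⁻¹ ^ (m ℕ.* m ℕ.+ m)
    Q⁻ᵏ = q⁻¹ ^ (k ℕ.* k ℕ.+ k)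
    reversed = Π< i (λ l → 1# - q ^ (b₀ ℕ.+ (i ∸ suc l)))
    paired : ∀ l → l < i → 1# - q ^ (a₀ ℕ.+ l) ≈ (- q ^ (a₀ ℕ.+ l)) * (1# - q ^ (b₀ ℕ.+ (i ∸ suc l)))
    paired l l<i = 1-q^x≈-q^x*[1-q^y] (a₀ ℕ.+ l) (b₀ ℕ.+ (i ∸ suc l)) (trans (^-congʳ q exponent) (q^N*≈1 2))
      where
      regroup : ∀ u l j r → suc (((u ℕ.+ suc l) ℕ.+ r) ℕ.+ r) ℕ.+ l ℕ.+ (suc (j ℕ.+ j ℕ.+ 1) ℕ.+ u) ≡ suc ((u ℕ.+ suc l) ℕ.+ j ℕ.+ r) ℕ.* 2
      regroup = solve-∀
      exponent : a₀ ℕ.+ l ℕ.+ (b₀ ℕ.+ (i ∸ suc l)) ≡ N ℕ.* 2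
      exponent = ≡.subst (λ n → a₀ ℕ.+ l ℕ.+ (b₀ ℕ.+ (i ∸ suc l)) ≡ suc n ℕ.* 2) i+j+r≡N′
        (≡.subst (λ i′ → suc ((i′ ℕ.+ r) ℕ.+ r) ℕ.+ l ℕ.+ (b₀ ℕ.+ (i ∸ suc l)) ≡ suc (i′ ℕ.+ j ℕ.+ r) ℕ.* 2)
                 (ℕ.m∸n+n≡m l<i) (regroup (i ∸ suc l) l j r))
    shift : Q⁻ᵐ * q ^ (i ℕ.* a₀) ≈ Q⁻ᵏ
    shift = begin
      Q⁻ᵐ * q ^ (i ℕ.* a₀)                                ≈⟨ *-congʳ (q⁻¹^ _) ⟩
      q ^ (N′ ℕ.* (m ℕ.* m ℕ.+ m)) * q ^ (i ℕ.* a₀)        ≈⟨ sym (^-homo-* q (N′ ℕ.* (m ℕ.* m ℕ.+ m)) (i ℕ.* a₀)) ⟩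
      q ^ (N′ ℕ.* (m ℕ.* m ℕ.+ m) ℕ.+ i ℕ.* a₀)
        ≈⟨ ^-mod-N (N′ ℕ.* (m ℕ.* m ℕ.+ m) ℕ.+ i ℕ.* a₀) (N′ ℕ.* (k ℕ.* k ℕ.+ k)) (k ℕ.* k ℕ.+ k ℕ.+ r) (m ℕ.* m ℕ.+ m ℕ.+ i ℕ.+ j) exponent ⟩
      q ^ (N′ ℕ.* (k ℕ.* k ℕ.+ k))                        ≈⟨ sym (q⁻¹^ _) ⟩
      Q⁻ᵏ                                                 ∎
      where
      regroup : ∀ i j r → (i ℕ.+ j ℕ.+ r) ℕ.* ((i ℕ.+ r) ℕ.* (i ℕ.+ r) ℕ.+ (i ℕ.+ r)) ℕ.+ i ℕ.* suc ((i ℕ.+ r) ℕ.+ r)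
                            ℕ.+ suc (i ℕ.+ j ℕ.+ r) ℕ.* ((i ℕ.+ j) ℕ.* (i ℕ.+ j) ℕ.+ (i ℕ.+ j) ℕ.+ r)
                        ≡ (i ℕ.+ j ℕ.+ r) ℕ.* ((i ℕ.+ j) ℕ.* (i ℕ.+ j) ℕ.+ (i ℕ.+ j))
                            ℕ.+ suc (i ℕ.+ j ℕ.+ r) ℕ.* ((i ℕ.+ r) ℕ.* (i ℕ.+ r) ℕ.+ (i ℕ.+ r) ℕ.+ i ℕ.+ j)
      regroup = solve-∀
      exponent : N′ ℕ.* (m ℕ.* m ℕ.+ m) ℕ.+ i ℕ.* a₀ ℕ.+ N ℕ.* (k ℕ.* k ℕ.+ k ℕ.+ r) ≡ N′ ℕ.* (k ℕ.* k ℕ.+ k) ℕ.+ N ℕ.* (m ℕ.* m ℕ.+ m ℕ.+ i ℕ.+ j)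
      exponent = ≡.subst (λ n → n ℕ.* (m ℕ.* m ℕ.+ m) ℕ.+ i ℕ.* a₀ ℕ.+ suc n ℕ.* (k ℕ.* k ℕ.+ k ℕ.+ r)
                              ≡ n ℕ.* (k ℕ.* k ℕ.+ k) ℕ.+ suc n ℕ.* (m ℕ.* m ℕ.+ m ℕ.+ i ℕ.+ j))
                         i+j+r≡N′ (regroup i j r)
    lhs : Q⁻ᵐ * [ m ℕ.+ m , m ℕ.+ r ] * poch 1 i ≈ Q⁻ᵏ * sgn R i * q ^ tri R (i ∸ 1) * reversed
    lhs = begin
      Q⁻ᵐ * [ m ℕ.+ m , m ℕ.+ r ] * poch 1 i
        ≈⟨ trans (*-assoc _ _ _) (*-congˡ (*-congʳ (reflexive (≡.cong [_, m ℕ.+ r ] (regroup i r))))) ⟩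
      Q⁻ᵐ * ([ (m ℕ.+ r) ℕ.+ i , m ℕ.+ r ] * poch 1 i)   ≈⟨ *-congˡ (gauss*poch-coindex (m ℕ.+ r) i) ⟩
      Q⁻ᵐ * poch a₀ i                                     ≈⟨ *-congˡ (trans (prod-cong-< i paired) (prod-* i _ _)) ⟩
      Q⁻ᵐ * (Π< i (λ l → - q ^ (a₀ ℕ.+ l)) * reversed)    ≈⟨ *-congˡ (*-congʳ (prod-neg-powers i a₀)) ⟩
      Q⁻ᵐ * (sgn R i * q ^ (i ℕ.* a₀ ℕ.+ tri R (i ∸ 1)) * reversed)
        ≈⟨ *-congˡ (*-congʳ (*-congˡ (^-homo-* q (i ℕ.* a₀) (tri R (i ∸ 1))))) ⟩
      Q⁻ᵐ * (sgn R i * (q ^ (i ℕ.* a₀) * q ^ tri R (i ∸ 1)) * reversed)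
        ≈⟨ solve 5 (λ A s x t v → A :* (s :* (x :* t) :* v) := (A :* x) :* s :* t :* v) refl _ _ _ _ _ ⟩
      (Q⁻ᵐ * q ^ (i ℕ.* a₀)) * sgn R i * q ^ tri R (i ∸ 1) * reversed ≈⟨ *-congʳ (*-congʳ (*-congʳ shift)) ⟩
      Q⁻ᵏ * sgn R i * q ^ tri R (i ∸ 1) * reversed                   ∎
      where
      regroup : ∀ i r → (i ℕ.+ r) ℕ.+ (i ℕ.+ r) ≡ ((i ℕ.+ r) ℕ.+ r) ℕ.+ i
      regroup = solve-∀
    rhs : Q⁻ᵏ * (sgn R i * q ^ tri R (i ∸ 1) * [ i ℕ.+ (j ℕ.+ j ℕ.+ 1) , i ]) * poch 1 i ≈ Q⁻ᵏ * sgn R i * q ^ tri R (i ∸ 1) * reversed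
    rhs = begin
      Q⁻ᵏ * (sgn R i * q ^ tri R (i ∸ 1) * [ i ℕ.+ (j ℕ.+ j ℕ.+ 1) , i ]) * poch 1 i
        ≈⟨ solve 5 (λ a b c d e → a :* (b :* c :* d) :* e := a :* b :* c :* (d :* e)) refl _ _ _ _ _ ⟩
      Q⁻ᵏ * sgn R i * q ^ tri R (i ∸ 1) * ([ i ℕ.+ (j ℕ.+ j ℕ.+ 1) , i ] * poch 1 i)
        ≈⟨ *-congˡ (trans (gauss*poch-index i (j ℕ.+ j ℕ.+ 1)) (prod-reverse i _)) ⟩
      Q⁻ᵏ * sgn R i * q ^ tri R (i ∸ 1) * reversed ∎

  private
    column-term-reindexed : ∀ k i → i ≤ k → k ≤ N′ →
      q⁻¹ ^ ((N′ ∸ (k ∸ i)) ℕ.* (N′ ∸ (k ∸ i)) ℕ.+ (N′ ∸ (k ∸ i))) * [ (N′ ∸ (k ∸ i)) ℕ.+ (N′ ∸ (k ∸ i)) , (N′ ∸ (k ∸ i)) ℕ.+ (N′ ∸ k) ]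
        ≈ q⁻¹ ^ (k ℕ.* k ℕ.+ k) * (sgn R i * q ^ tri R (i ∸ 1) * [ (2 ℕ.* k ℕ.+ 1) ∸ i , i ])
    column-term-reindexed k i i≤k k≤N′ with ℕ.m≤n⇒∃[o]m+o≡n i≤k
    ... | j , ≡.refl = begin
      q⁻¹ ^ (m ℕ.* m ℕ.+ m) * [ m ℕ.+ m , m ℕ.+ r ]
        ≈⟨ reflexive (≡.cong (λ m → q⁻¹ ^ (m ℕ.* m ℕ.+ m) * [ m ℕ.+ m , m ℕ.+ r ]) m≡i+r) ⟩
      q⁻¹ ^ ((i ℕ.+ r) ℕ.* (i ℕ.+ r) ℕ.+ (i ℕ.+ r)) * [ (i ℕ.+ r) ℕ.+ (i ℕ.+ r) , (i ℕ.+ r) ℕ.+ r ]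
        ≈⟨ column-term i j r i+j+r≡N′ ⟩
      q⁻¹ ^ ((i ℕ.+ j) ℕ.* (i ℕ.+ j) ℕ.+ (i ℕ.+ j)) * (sgn R i * q ^ tri R (i ∸ 1) * [ i ℕ.+ (j ℕ.+ j ℕ.+ 1) , i ])
        ≈⟨ *-congˡ (*-congˡ (reflexive (≡.cong [_, i ] (≡.sym 2k+1∸i≡)))) ⟩
      q⁻¹ ^ ((i ℕ.+ j) ℕ.* (i ℕ.+ j) ℕ.+ (i ℕ.+ j)) * (sgn R i * q ^ tri R (i ∸ 1) * [ (2 ℕ.* (i ℕ.+ j) ℕ.+ 1) ∸ i , i ]) ∎
      where
      r = N′ ∸ (i ℕ.+ j)
      m = N′ ∸ ((i ℕ.+ j) ∸ i)
      i+j+r≡N′ : i ℕ.+ j ℕ.+ r ≡ N′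
      i+j+r≡N′ = ℕ.m+[n∸m]≡n k≤N′
      regroup₁ : ∀ i j r → i ℕ.+ j ℕ.+ r ≡ j ℕ.+ (i ℕ.+ r)
      regroup₁ = solve-∀
      m≡i+r : m ≡ i ℕ.+ r
      m≡i+r = ≡.trans (≡.cong (N′ ∸_) (ℕ.m+n∸m≡n i j))
        (≡.trans (≡.cong (_∸ j) (≡.trans (≡.sym i+j+r≡N′) (regroup₁ i j r))) (ℕ.m+n∸m≡n j (i ℕ.+ r)))
      regroup₂ : ∀ i j → 2 ℕ.* (i ℕ.+ j) ℕ.+ 1 ≡ i ℕ.+ (i ℕ.+ (j ℕ.+ j ℕ.+ 1))
      regroup₂ = solve-∀
      2k+1∸i≡ : (2 ℕ.* (i ℕ.+ j) ℕ.+ 1) ∸ i ≡ i ℕ.+ (j ℕ.+ j ℕ.+ 1)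
      2k+1∸i≡ = ≡.trans (≡.cong (_∸ i) (regroup₂ i j)) (ℕ.m+n∸m≡n i _)

  columnSum≈D : ∀ k → k < N → columnSum (N′ ∸ k) ≈ q⁻¹ ^ (k ℕ.* k ℕ.+ k) * D (2 ℕ.* k ℕ.+ 1)
  columnSum≈D k k<N = begin
    columnSum (N′ ∸ k)                          ≈⟨ sum-reverse N f ⟩
    Σ< N (λ j → f (N′ ∸ j))                     ≈⟨ sum-extend _ k<N beyond-k ⟩
    Σ< (suc k) (λ j → f (N′ ∸ j))               ≈⟨ sum-reverse (suc k) _ ⟩
    Σ< (suc k) (λ i → f (N′ ∸ (k ∸ i)))
      ≈⟨ sum-cong-< (suc k) (λ i i<k+1 → column-term-reindexed k i (ℕ.≤-pred i<k+1) (ℕ.≤-pred k<N)) ⟩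
    Σ< (suc k) (λ i → q⁻¹ ^ (k ℕ.* k ℕ.+ k) * d i) ≈⟨ sym (sum-*ˡ (suc k) _ d) ⟩
    q⁻¹ ^ (k ℕ.* k ℕ.+ k) * Σ< (suc k) d         ≈⟨ *-congˡ (sym (sum-extend d (s≤s (ℕ.≤-trans (ℕ.m≤m+n k (k ℕ.+ 0)) (ℕ.m≤m+n _ 1))) beyond-k′)) ⟩
    q⁻¹ ^ (k ℕ.* k ℕ.+ k) * D (2 ℕ.* k ℕ.+ 1)    ∎
    where
    f d : ℕ → Carrier
    f m = q⁻¹ ^ (m ℕ.* m ℕ.+ m) * [ m ℕ.+ m , m ℕ.+ (N′ ∸ k) ]
    d i = sgn R i * q ^ tri R (i ∸ 1) * [ (2 ℕ.* k ℕ.+ 1) ∸ i , i ]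
    beyond-k : ∀ j → suc k ≤ j → j < N → f (N′ ∸ j) ≈ 0#
    beyond-k j k<j j<N = trans (*-congˡ (gauss≈0 (ℕ.+-monoʳ-< (N′ ∸ j) (ℕ.∸-monoʳ-< k<j (ℕ.≤-pred j<N))))) (zeroʳ _)
    2k+1∸[k+1]≡k : (2 ℕ.* k ℕ.+ 1) ∸ suc k ≡ k
    2k+1∸[k+1]≡k = ≡.trans (≡.cong (_∸ suc k) (regroup k)) (ℕ.m+n∸m≡n (suc k) k)
      where
      regroup : ∀ k → 2 ℕ.* k ℕ.+ 1 ≡ suc k ℕ.+ k
      regroup = solve-∀
    beyond-k′ : ∀ i → suc k ≤ i → i < suc (2 ℕ.* k ℕ.+ 1) → d i ≈ 0#
    beyond-k′ i k<i _ = trans (*-congˡ (gauss≈0 (ℕ.≤-<-trans (ℕ.∸-monoʳ-≤ (2 ℕ.* k ℕ.+ 1) k<i) (≡.subst (_< i) (≡.sym 2k+1∸[k+1]≡k) k<i)))) (zeroʳ _)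

module Assembly {ℓ₁ ℓ₂} (R : CommutativeRing ℓ₁ ℓ₂) (isField : IsFieldCR R)
                (N′ : ℕ) (q : CommutativeRing.Carrier R) (q-primitive : PrimitiveRoot R (suc N′) q) where
  open CommutativeRing R hiding (zero)
  open import Algebra.Definitions.RawSemiring (Semiring.rawSemiring semiring) using (_^_)
  open import Algebra.Properties.Semiring.Exp semiring using (^-homo-*; ^-congʳ)
  open IntegerCoefficientSolver R
  open FiniteSums R
  open GaussianBinomials R q
  open TriangularNumbers R
  open DiagonalSums R q using (D; D-odd)
  open UnitBaileyPair R q using (α)
  open PrimitiveRootOfUnity R isField N′ q q-primitive
  open BaileyLemma R isField N′ q q-primitive using (inner-isBaileyPair; chainA)
  open ColumnSums R isField N′ q q-primitive using (columnSum; columnSum≈D)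
  open import Relation.Binary.Reasoning.Setoid setoid

  β : ℕ → Carrier
  β k = βq R N q (k ℕ./ 3) (k ℕ.% 3)

  private
    -- After tri-+ both sides are polynomial except for tri s + tri s and tri k + tri k,
    -- which tri-double removes.
    α-upper-exponent : ∀ k s →
      tri R (k ℕ.+ suc s) ℕ.+ tri R s ℕ.+ suc s ℕ.+ (k ℕ.+ suc s) ℕ.* (k ℕ.* k ℕ.+ k) ℕ.+ suc (k ℕ.+ suc s) ℕ.* tri R k
        ≡ (k ℕ.+ suc s) ℕ.* tri R k ℕ.+ suc (k ℕ.+ suc s) ℕ.* (suc s ℕ.+ k ℕ.* k ℕ.+ k)
    α-upper-exponent k s =
      ≡.trans (≡.cong (λ t → t ℕ.+ tri R s ℕ.+ suc s ℕ.+ (k ℕ.+ suc s) ℕ.* (k ℕ.* k ℕ.+ k) ℕ.+ suc (k ℕ.+ suc s) ℕ.* tri R k) (tri-+ k (suc s)))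
      (≡.trans (regroup₁ k s (tri R s) (tri R k))
      (≡.trans (≡.cong₂ (λ S T → S ℕ.+ T ℕ.+ (suc s ℕ.+ suc s ℕ.+ k ℕ.* suc s ℕ.+ (k ℕ.+ suc s) ℕ.* (k ℕ.* k ℕ.+ k)) ℕ.+ (k ℕ.+ suc s) ℕ.* tri R k)
                        (tri-double s) (tri-double k))
               (regroup₂ k s (tri R k))))
      where
      regroup₁ : ∀ k s S T → (T ℕ.+ (suc s ℕ.+ S) ℕ.+ k ℕ.* suc s) ℕ.+ S ℕ.+ suc s ℕ.+ (k ℕ.+ suc s) ℕ.* (k ℕ.* k ℕ.+ k) ℕ.+ suc (k ℕ.+ suc s) ℕ.* T
                            ≡ (S ℕ.+ S) ℕ.+ (T ℕ.+ T) ℕ.+ (suc s ℕ.+ suc s ℕ.+ k ℕ.* suc s ℕ.+ (k ℕ.+ suc s) ℕ.* (k ℕ.* k ℕ.+ k)) ℕ.+ (k ℕ.+ suc s) ℕ.* T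
      regroup₁ = solve-∀
      regroup₂ : ∀ k s T → s ℕ.* suc s ℕ.+ k ℕ.* suc k ℕ.+ (suc s ℕ.+ suc s ℕ.+ k ℕ.* suc s ℕ.+ (k ℕ.+ suc s) ℕ.* (k ℕ.* k ℕ.+ k)) ℕ.+ (k ℕ.+ suc s) ℕ.* T
                         ≡ (k ℕ.+ suc s) ℕ.* T ℕ.+ suc (k ℕ.+ suc s) ℕ.* (suc s ℕ.+ k ℕ.* k ℕ.+ k)
      regroup₂ = solve-∀

    α-lower-exponent : ∀ k s →
      tri R (k ℕ.+ suc s) ℕ.+ tri R s ℕ.+ (k ℕ.+ suc s) ℕ.* (k ℕ.* k ℕ.+ k) ℕ.+ suc (k ℕ.+ suc s) ℕ.* (tri R k ℕ.+ 1)
        ≡ ((k ℕ.+ suc s) ℕ.* tri R (suc k) ℕ.+ 2 ℕ.* suc k) ℕ.+ suc (k ℕ.+ suc s) ℕ.* (s ℕ.+ k ℕ.* k)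
    α-lower-exponent k s =
      ≡.trans (≡.cong (λ t → t ℕ.+ tri R s ℕ.+ (k ℕ.+ suc s) ℕ.* (k ℕ.* k ℕ.+ k) ℕ.+ suc (k ℕ.+ suc s) ℕ.* (tri R k ℕ.+ 1)) (tri-+ k (suc s)))
      (≡.trans (regroup₁ k s (tri R s) (tri R k))
      (≡.trans (≡.cong₂ (λ S T → S ℕ.+ T ℕ.+ (suc s ℕ.+ k ℕ.* suc s ℕ.+ (k ℕ.+ suc s) ℕ.* (k ℕ.* k ℕ.+ k) ℕ.+ suc (k ℕ.+ suc s)) ℕ.+ (k ℕ.+ suc s) ℕ.* tri R k)
                        (tri-double s) (tri-double k))
               (regroup₂ k s (tri R k))))
      where
      regroup₁ : ∀ k s S T → (T ℕ.+ (suc s ℕ.+ S) ℕ.+ k ℕ.* suc s) ℕ.+ S ℕ.+ (k ℕ.+ suc s) ℕ.* (k ℕ.* k ℕ.+ k) ℕ.+ suc (k ℕ.+ suc s) ℕ.* (T ℕ.+ 1)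
                            ≡ (S ℕ.+ S) ℕ.+ (T ℕ.+ T) ℕ.+ (suc s ℕ.+ k ℕ.* suc s ℕ.+ (k ℕ.+ suc s) ℕ.* (k ℕ.* k ℕ.+ k) ℕ.+ suc (k ℕ.+ suc s)) ℕ.+ (k ℕ.+ suc s) ℕ.* T
      regroup₁ = solve-∀
      regroup₂ : ∀ k s T → s ℕ.* suc s ℕ.+ k ℕ.* suc k ℕ.+ (suc s ℕ.+ k ℕ.* suc s ℕ.+ (k ℕ.+ suc s) ℕ.* (k ℕ.* k ℕ.+ k) ℕ.+ suc (k ℕ.+ suc s)) ℕ.+ (k ℕ.+ suc s) ℕ.* T
                         ≡ (k ℕ.+ suc s) ℕ.* (suc k ℕ.+ T) ℕ.+ 2 ℕ.* suc k ℕ.+ suc (k ℕ.+ suc s) ℕ.* (s ℕ.+ k ℕ.* k)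
      regroup₂ = solve-∀

    sgn-complement : ∀ k s → k ℕ.+ suc s ≡ N′ → sgn R (suc s) ≈ sgn R k * q ^ tri R N′
    sgn-complement k s k+s+1≡N′ = begin
      sgn R (suc s)                          ≈⟨ sym (trans (*-congʳ (sgn*sgn k)) (*-identityˡ _)) ⟩
      (sgn R k * sgn R k) * sgn R (suc s)    ≈⟨ *-assoc _ _ _ ⟩
      sgn R k * (sgn R k * sgn R (suc s))    ≈⟨ *-congˡ (sym (sgn-+ k (suc s))) ⟩
      sgn R k * sgn R (k ℕ.+ suc s)          ≈⟨ *-congˡ (reflexive (≡.cong (sgn R) k+s+1≡N′)) ⟩
      sgn R k * sgn R N′                     ≈⟨ *-congˡ (sym q^tri≈sgn) ⟩
      sgn R k * q ^ tri R N′                 ∎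

  -- With N′ = k + s + 1, the two halves of α (s + 1) = (-1)^{s+1} q^{tri s} (1 + q^{s+1}) become
  -- the two terms of the telescoping sum once exponents are reduced modulo N.
  α-upper-half : ∀ k s → k ℕ.+ suc s ≡ N′ →
    sgn R (suc s) * q ^ tri R s * q ^ suc s * q⁻¹ ^ (k ℕ.* k ℕ.+ k) ≈ sgn R k * q⁻¹ ^ tri R k
  α-upper-half k s k+s+1≡N′ = begin
    sgn R (suc s) * q ^ tri R s * q ^ suc s * q⁻¹ ^ (k ℕ.* k ℕ.+ k)
      ≈⟨ *-cong (*-congʳ (*-congʳ (sgn-complement k s k+s+1≡N′))) (q⁻¹^ (k ℕ.* k ℕ.+ k)) ⟩
    sgn R k * q ^ tri R N′ * q ^ tri R s * q ^ suc s * q ^ (N′ ℕ.* (k ℕ.* k ℕ.+ k))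
      ≈⟨ solve 5 (λ a b c d f → a :* b :* c :* d :* f := a :* (b :* c :* d :* f)) refl _ _ _ _ _ ⟩
    sgn R k * (q ^ tri R N′ * q ^ tri R s * q ^ suc s * q ^ (N′ ℕ.* (k ℕ.* k ℕ.+ k)))
      ≈⟨ *-congˡ (trans (*-congʳ (trans (*-congʳ (sym (^-homo-* q (tri R N′) (tri R s)))) (sym (^-homo-* q (tri R N′ ℕ.+ tri R s) (suc s)))))
                        (sym (^-homo-* q (tri R N′ ℕ.+ tri R s ℕ.+ suc s) (N′ ℕ.* (k ℕ.* k ℕ.+ k))))) ⟩
    sgn R k * q ^ (tri R N′ ℕ.+ tri R s ℕ.+ suc s ℕ.+ N′ ℕ.* (k ℕ.* k ℕ.+ k))
      ≈⟨ *-congˡ (^-mod-N (tri R N′ ℕ.+ tri R s ℕ.+ suc s ℕ.+ N′ ℕ.* (k ℕ.* k ℕ.+ k)) (N′ ℕ.* tri R k) (tri R k) (suc s ℕ.+ k ℕ.* k ℕ.+ k) exponent) ⟩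
    sgn R k * q ^ (N′ ℕ.* tri R k) ≈⟨ *-congˡ (sym (q⁻¹^ _)) ⟩
    sgn R k * q⁻¹ ^ tri R k ∎
    where
    exponent : tri R N′ ℕ.+ tri R s ℕ.+ suc s ℕ.+ N′ ℕ.* (k ℕ.* k ℕ.+ k) ℕ.+ N ℕ.* tri R k ≡ N′ ℕ.* tri R k ℕ.+ N ℕ.* (suc s ℕ.+ k ℕ.* k ℕ.+ k)
    exponent = ≡.subst (λ n → tri R n ℕ.+ tri R s ℕ.+ suc s ℕ.+ n ℕ.* (k ℕ.* k ℕ.+ k) ℕ.+ suc n ℕ.* tri R k
                            ≡ n ℕ.* tri R k ℕ.+ suc n ℕ.* (suc s ℕ.+ k ℕ.* k ℕ.+ k))
                       k+s+1≡N′ (α-upper-exponent k s)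

  α-lower-half : ∀ k s → k ℕ.+ suc s ≡ N′ →
    sgn R (suc s) * q ^ tri R s * q⁻¹ ^ (k ℕ.* k ℕ.+ k) ≈ sgn R k * (q⁻¹ ^ tri R (suc k) * q ^ (2 ℕ.* suc k))
  α-lower-half k s k+s+1≡N′ = begin
    sgn R (suc s) * q ^ tri R s * q⁻¹ ^ (k ℕ.* k ℕ.+ k)
      ≈⟨ *-cong (*-congʳ (sgn-complement k s k+s+1≡N′)) (q⁻¹^ _) ⟩
    sgn R k * q ^ tri R N′ * q ^ tri R s * q ^ (N′ ℕ.* (k ℕ.* k ℕ.+ k))
      ≈⟨ solve 4 (λ a b c d → a :* b :* c :* d := a :* (b :* c :* d)) refl _ _ _ _ ⟩
    sgn R k * (q ^ tri R N′ * q ^ tri R s * q ^ (N′ ℕ.* (k ℕ.* k ℕ.+ k)))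
      ≈⟨ *-congˡ (trans (*-congʳ (sym (^-homo-* q (tri R N′) (tri R s)))) (sym (^-homo-* q (tri R N′ ℕ.+ tri R s) (N′ ℕ.* (k ℕ.* k ℕ.+ k))))) ⟩
    sgn R k * q ^ (tri R N′ ℕ.+ tri R s ℕ.+ N′ ℕ.* (k ℕ.* k ℕ.+ k))
      ≈⟨ *-congˡ (^-mod-N (tri R N′ ℕ.+ tri R s ℕ.+ N′ ℕ.* (k ℕ.* k ℕ.+ k)) (N′ ℕ.* tri R (suc k) ℕ.+ 2 ℕ.* suc k) (tri R k ℕ.+ 1) (s ℕ.+ k ℕ.* k) exponent) ⟩
    sgn R k * q ^ (N′ ℕ.* tri R (suc k) ℕ.+ 2 ℕ.* suc k)
      ≈⟨ *-congˡ (trans (^-homo-* q (N′ ℕ.* tri R (suc k)) (2 ℕ.* suc k)) (*-congʳ (sym (q⁻¹^ (tri R (suc k)))))) ⟩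
    sgn R k * (q⁻¹ ^ tri R (suc k) * q ^ (2 ℕ.* suc k)) ∎
    where
    exponent : tri R N′ ℕ.+ tri R s ℕ.+ N′ ℕ.* (k ℕ.* k ℕ.+ k) ℕ.+ N ℕ.* (tri R k ℕ.+ 1) ≡ (N′ ℕ.* tri R (suc k) ℕ.+ 2 ℕ.* suc k) ℕ.+ N ℕ.* (s ℕ.+ k ℕ.* k)
    exponent = ≡.subst (λ n → tri R n ℕ.+ tri R s ℕ.+ n ℕ.* (k ℕ.* k ℕ.+ k) ℕ.+ suc n ℕ.* (tri R k ℕ.+ 1)
                            ≡ (n ℕ.* tri R (suc k) ℕ.+ 2 ℕ.* suc k) ℕ.+ suc n ℕ.* (s ℕ.+ k ℕ.* k))
                       k+s+1≡N′ (α-lower-exponent k s)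

  module _ (p′ : ℕ) where
    p : ℕ
    p = suc p′

    summand : ℕ → Carrier
    summand k = q ^ (p ℕ.* ((N′ ∸ k) ℕ.* (N′ ∸ k))) * α (N′ ∸ k) * (q⁻¹ ^ (k ℕ.* k ℕ.+ k) * β k)

    H9≈sum-summand : H9 R N q p ≈ Σ< N summand
    H9≈sum-summand = begin
      H9 R N q p
        ≈⟨ sum-cong-< N expand ⟩
      Σ< N (λ m → Σ< N (λ r → q⁻¹ ^ (m ℕ.* m ℕ.+ m) * ([ m ℕ.+ m , m ℕ.+ r ] * chainA p′ r)))
        ≈⟨ sum-swap N N _ ⟩
      Σ< N (λ r → Σ< N (λ m → q⁻¹ ^ (m ℕ.* m ℕ.+ m) * ([ m ℕ.+ m , m ℕ.+ r ] * chainA p′ r)))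
        ≈⟨ sum-cong N (λ r → trans (sum-cong N (λ m → solve 3 (λ Q G A → Q :* (G :* A) := A :* (Q :* G)) refl _ _ _))
                                   (sym (sum-*ˡ N (chainA p′ r) _))) ⟩
      Σ< N (λ r → chainA p′ r * columnSum r)                  ≈⟨ sum-reverse N _ ⟩
      Σ< N (λ k → chainA p′ (N′ ∸ k) * columnSum (N′ ∸ k))
        ≈⟨ sum-cong-< N (λ k k<N → *-congˡ (trans (columnSum≈D k k<N) (*-congˡ (D-odd N k)))) ⟩
      Σ< N summand                                            ∎
      where
      expand : ∀ m → m < N → q⁻¹ ^ (m ℕ.* m ℕ.+ m) * poch (suc m) m * inner R q p′ m
                             ≈ Σ< N (λ r → q⁻¹ ^ (m ℕ.* m ℕ.+ m) * ([ m ℕ.+ m , m ℕ.+ r ] * chainA p′ r))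
      expand m m<N = begin
        q⁻¹ ^ (m ℕ.* m ℕ.+ m) * poch (suc m) m * inner R q p′ m   ≈⟨ *-assoc _ _ _ ⟩
        q⁻¹ ^ (m ℕ.* m ℕ.+ m) * (poch (suc m) m * inner R q p′ m) ≈⟨ *-congˡ (inner-isBaileyPair p′ m m<N) ⟩
        q⁻¹ ^ (m ℕ.* m ℕ.+ m) * Σ< (suc m) (λ r → [ m ℕ.+ m , m ℕ.+ r ] * chainA p′ r) ≈⟨ sum-*ˡ (suc m) _ _ ⟩
        Σ< (suc m) (λ r → q⁻¹ ^ (m ℕ.* m ℕ.+ m) * ([ m ℕ.+ m , m ℕ.+ r ] * chainA p′ r))
          ≈⟨ sym (sum-extend _ m<N (λ r m<r _ → trans (*-congˡ (trans (*-congʳ (gauss≈0 (ℕ.+-monoʳ-< m m<r))) (zeroˡ _))) (zeroʳ _))) ⟩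
        Σ< N (λ r → q⁻¹ ^ (m ℕ.* m ℕ.+ m) * ([ m ℕ.+ m , m ℕ.+ r ] * chainA p′ r)) ∎

    g u v : ℕ → Carrier
    g k = sgn R k * q⁻¹ ^ tri R k * astar R N q p k
    u k = q ^ p * (sgn R k * q⁻¹ ^ tri R k * b R N q p k)
    v k = q ^ p * (sgn R (suc k) * q⁻¹ ^ tri R (suc k) * (q ^ (2 ℕ.* suc k) * b R N q p k))

    RHS-telescopes : ∀ n → q ^ p * Σ< (suc n) g ≈ Σ< (suc n) u - Σ< n v
    RHS-telescopes zero    = solve 2 (λ P X → P :* (con (0 , 0) :+ X) := (con (0 , 0) :+ P :* X) :- con (0 , 0)) refl _ _
    RHS-telescopes (suc n) = begin
      q ^ p * (Σ< (suc n) g + g (suc n))                   ≈⟨ distribˡ _ _ _ ⟩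
      q ^ p * Σ< (suc n) g + q ^ p * g (suc n)             ≈⟨ +-cong (RHS-telescopes n)
                                                               (solve 5 (λ P s Q B X → P :* (s :* Q :* (B :- X)) := P :* (s :* Q :* B) :- P :* (s :* Q :* X)) refl _ _ _ _ _) ⟩
      (Σ< (suc n) u - Σ< n v) + (u (suc n) - v n)          ≈⟨ solve 4 (λ a b c d → (a :- b) :+ (c :- d) := (a :+ c) :- (b :+ d)) refl _ _ _ _ ⟩
      Σ< (suc (suc n)) u - Σ< (suc n) v                    ∎

    summand≈u-v : ∀ k → suc k ≤ N′ → summand k ≈ u k - v k
    summand≈u-v k k<N′ with ℕ.m≤n⇒∃[o]m+o≡n k<N′
    ... | s , k+1+s≡N′ = begin
      q ^ (p ℕ.* ((N′ ∸ k) ℕ.* (N′ ∸ k))) * α (N′ ∸ k) * (Q * β k)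
        ≈⟨ reflexive (≡.cong (λ z → q ^ (p ℕ.* (z ℕ.* z)) * α z * (Q * β k)) N′∸k≡s+1) ⟩
      q ^ (p ℕ.* (suc s ℕ.* suc s)) * α (suc s) * (Q * β k)
        ≈⟨ *-congʳ (*-congʳ (trans (^-mod-N (p ℕ.* (suc s ℕ.* suc s)) (p ℕ.+ p ℕ.* (k ℕ.* k ℕ.+ 2 ℕ.* k)) (2 ℕ.* p ℕ.* suc k) (p ℕ.* N) exponent)
                                   (^-homo-* q p (p ℕ.* (k ℕ.* k ℕ.+ 2 ℕ.* k))))) ⟩
      (q ^ p * E) * (sgn R (suc s) * q ^ tri R s * (1# + q ^ suc s)) * (Q * β k)
        ≈⟨ solve 8 (λ P E S T Q QI B U → (P :* E) :* (S :* T :* (con (1 , 0) :+ U)) :* (QI :* B) := P :* E :* B :* (S :* T :* QI :+ S :* T :* U :* QI))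
                   refl (q ^ p) E (sgn R (suc s)) (q ^ tri R s) q Q (β k) (q ^ suc s) ⟩
      q ^ p * E * β k * (sgn R (suc s) * q ^ tri R s * Q + sgn R (suc s) * q ^ tri R s * q ^ suc s * Q)
        ≈⟨ *-congˡ (+-cong (α-lower-half k s k+s+1≡N′) (α-upper-half k s k+s+1≡N′)) ⟩
      q ^ p * E * β k * (sgn R k * (q⁻¹ ^ tri R (suc k) * q ^ (2 ℕ.* suc k)) + sgn R k * q⁻¹ ^ tri R k)
        ≈⟨ solve 7 (λ P E B s Z X Y → P :* E :* B :* (s :* (Z :* X) :+ s :* Y) := P :* (s :* Y :* (E :* B)) :- P :* ((:- s) :* Z :* (X :* (E :* B))))
                   refl (q ^ p) E (β k) (sgn R k) (q⁻¹ ^ tri R (suc k)) (q ^ (2 ℕ.* suc k)) (q⁻¹ ^ tri R k) ⟩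
      u k - v k ∎
      where
      E = q ^ (p ℕ.* (k ℕ.* k ℕ.+ 2 ℕ.* k))
      Q = q⁻¹ ^ (k ℕ.* k ℕ.+ k)
      k+s+1≡N′ : k ℕ.+ suc s ≡ N′
      k+s+1≡N′ = ≡.trans (ℕ.+-suc k s) k+1+s≡N′
      N′∸k≡s+1 : N′ ∸ k ≡ suc s
      N′∸k≡s+1 = ≡.trans (≡.cong (_∸ k) (≡.sym k+s+1≡N′)) (ℕ.m+n∸m≡n k (suc s))
      regroup : ∀ p k s → p ℕ.* (suc s ℕ.* suc s) ℕ.+ suc (k ℕ.+ suc s) ℕ.* (2 ℕ.* p ℕ.* suc k)
                          ≡ p ℕ.+ p ℕ.* (k ℕ.* k ℕ.+ 2 ℕ.* k) ℕ.+ suc (k ℕ.+ suc s) ℕ.* (p ℕ.* suc (k ℕ.+ suc s))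
      regroup = solve-∀
      exponent : p ℕ.* (suc s ℕ.* suc s) ℕ.+ N ℕ.* (2 ℕ.* p ℕ.* suc k) ≡ p ℕ.+ p ℕ.* (k ℕ.* k ℕ.+ 2 ℕ.* k) ℕ.+ N ℕ.* (p ℕ.* N)
      exponent = ≡.subst (λ n → p ℕ.* (suc s ℕ.* suc s) ℕ.+ suc n ℕ.* (2 ℕ.* p ℕ.* suc k) ≡ p ℕ.+ p ℕ.* (k ℕ.* k ℕ.+ 2 ℕ.* k) ℕ.+ suc n ℕ.* (p ℕ.* suc n))
                         k+s+1≡N′ (regroup p k s)

    summand-last : summand N′ ≈ u N′
    summand-last = begin
      q ^ (p ℕ.* ((N′ ∸ N′) ℕ.* (N′ ∸ N′))) * α (N′ ∸ N′) * (q⁻¹ ^ (N′ ℕ.* N′ ℕ.+ N′) * β N′)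
        ≈⟨ reflexive (≡.cong (λ z → q ^ (p ℕ.* (z ℕ.* z)) * α z * (q⁻¹ ^ (N′ ℕ.* N′ ℕ.+ N′) * β N′)) (ℕ.n∸n≡0 N′)) ⟩
      q ^ (p ℕ.* 0) * 1# * (q⁻¹ ^ (N′ ℕ.* N′ ℕ.+ N′) * β N′)
        ≈⟨ *-cong (trans (*-identityʳ _) (^-congʳ q (ℕ.*-zeroʳ p)))
                  (trans (*-congʳ (trans (q⁻¹^ _) (trans (^-congʳ q (square N′)) (q^N*≈1 (N′ ℕ.* N′))))) (*-identityˡ _)) ⟩
      1# * β N′
        ≈⟨ *-congʳ (sym (trans (*-cong q^p*E≈1 q^tri*q⁻¹^tri≈1) (*-identityˡ 1#))) ⟩
      (q ^ p * q ^ (p ℕ.* (N′ ℕ.* N′ ℕ.+ 2 ℕ.* N′))) * (q ^ tri R N′ * q⁻¹ ^ tri R N′) * β N′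
        ≈⟨ *-congʳ (*-congˡ (*-congʳ q^tri≈sgn)) ⟩
      (q ^ p * q ^ (p ℕ.* (N′ ℕ.* N′ ℕ.+ 2 ℕ.* N′))) * (sgn R N′ * q⁻¹ ^ tri R N′) * β N′
        ≈⟨ solve 5 (λ P E S Q B → (P :* E) :* (S :* Q) :* B := P :* (S :* Q :* (E :* B))) refl _ _ _ _ _ ⟩
      u N′ ∎
      where
      square : ∀ n → n ℕ.* (n ℕ.* n ℕ.+ n) ≡ suc n ℕ.* (n ℕ.* n)
      square = solve-∀
      square′ : ∀ p n → p ℕ.+ p ℕ.* (n ℕ.* n ℕ.+ 2 ℕ.* n) ≡ suc n ℕ.* (p ℕ.* suc n)
      square′ = solve-∀
      q^p*E≈1 : q ^ p * q ^ (p ℕ.* (N′ ℕ.* N′ ℕ.+ 2 ℕ.* N′)) ≈ 1#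
      q^p*E≈1 = trans (sym (^-homo-* q p _)) (trans (^-congʳ q (square′ p N′)) (q^N*≈1 (p ℕ.* N)))
      q^tri*q⁻¹^tri≈1 : q ^ tri R N′ * q⁻¹ ^ tri R N′ ≈ 1#
      q^tri*q⁻¹^tri≈1 = trans (*-congˡ (q⁻¹^ (tri R N′))) (trans (sym (^-homo-* q (tri R N′) (N′ ℕ.* tri R N′))) (q^N*≈1 (tri R N′)))

    H9≈RHS9 : H9 R N q p ≈ RHS9 R N q p
    H9≈RHS9 = begin
      H9 R N q p                            ≈⟨ H9≈sum-summand ⟩
      Σ< N′ summand + summand N′            ≈⟨ +-cong (sum-cong-< N′ summand≈u-v) summand-last ⟩
      Σ< N′ (λ k → u k - v k) + u N′        ≈⟨ +-congʳ (sum-- N′ u v) ⟩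
      (Σ< N′ u - Σ< N′ v) + u N′            ≈⟨ solve 3 (λ a b c → (a :- b) :+ c := (a :+ c) :- b) refl _ _ _ ⟩
      Σ< N u - Σ< N′ v                      ≈⟨ sym (RHS-telescopes N′) ⟩
      RHS9 R N q p                          ∎

theorem2p14 : ∀ {c ℓ : Level} (R : CommutativeRing c ℓ) → IsFieldCR R → CharZero R →
              ∀ (p N : ℕ) → 1 ≤ p → 1 ≤ N → ∀ (q : CommutativeRing.Carrier R) →
              PrimitiveRoot R N q →
              CommutativeRing._≈_ R (H9 R N q p) (RHS9 R N q p)
theorem2p14 R isField _ (suc p′) (suc N′) _ _ q q-primitive = Assembly.H9≈RHS9 R isField N′ q q-primitive p′
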